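{- $$\sum_{n\ge0}S_n^{B,+}\frac{x^n}{n!}=\frac{\cos^2x}{\cos x-\sin x},\qquad \sum_{n\ge0}S_n^{B,- }\frac{x^n}{n!}=\frac{\sin^2x}{\cos x-\sin x},$$ $$\sum_{n\ge0}S_n^{D}\frac{x^n}{n!}=\frac{\cos^2x}{\cos x-\sin x},\qquad \sum_{n\ge0}S_n^{B-D}\frac{x^n}{n!}=\frac{\sin^2x}{\cos x-\sin x}.$$
   Context: $\mathfrak{B}_n$ is the group of signed permutations in window notation $\pi=\pi_1\cdots\pi_n$, with $\mathrm{inv}_B(\pi)=|\{i<j:\pi_i>\pi_j\}|+|\{i<j:-\pi_i>\pi_j\}|+|\{i:\pi_i<0\}|$; $\mathfrak{D}_n$ is the subset of $\mathfrak{B}_n$ with an even number of negative entries. A snake of type B is $\pi\in\mathfrak{B}_n$ with $0<\pi_1>\pi_2<\pi_3>\cdots$. For $n\ge1$, $S_n^{B,+}$ (resp. $S_n^{B,- }$) is the number of snakes with $\mathrm{inv}_B$ even (resp. odd), $S_n^D$ the number of snakes in $\mathfrak{D}_n$, and $S_n^{B-D}$ the number of snakes in $\mathfrak{B}_n\setminus\mathfrak{D}_n$. Conventions: $S_0^{B,+}=S_0^D=1$, $S_0^{B,- }=S_0^{B-D}=0$. -}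

module Defs where

open import Data.Bool using (Bool; true; false; _∧_; if_then_else_; not)
open import Data.Nat as ℕ using (ℕ; zero; suc; _!; _∸_; _%_)
open import Data.Nat.Properties using (_!≢0)
open import Data.Integer as ℤ using (ℤ; +_; -[1+_]; ∣_∣)
open import Data.Rational as ℚ using (ℚ; 0ℚ; 1ℚ; _/_)
open import Data.List using (List; []; _∷_; length; map; concatMap; filterᵇ; _++_)
open import Data.Bool.ListAction using (and)
open import Relation.Nullary.Decidable using (does)

-- Signed permutations in window notation

infix 4 _<ℤ_
_<ℤ_ : ℤ → ℤ → Bool
x <ℤ y = does (x ℤ.<? y)

_==ℕ_ : ℕ → ℕ → Bool
m ==ℕ n = does (m ℕ.≟ n)

entries : ℕ → List ℤ
entries n = map (λ k → + suc k) (Data.List.upTo n) ++ map (λ k → -[1+ k ]) (Data.List.upTo n)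
  where import Data.List

words : List ℤ → ℕ → List (List ℤ)
words A zero = [] ∷ []
words A (suc k) = concatMap (λ w → map (λ a → a ∷ w) A) (words A k)

distinctAbs : List ℤ → Bool
distinctAbs [] = true
distinctAbs (x ∷ xs) = and (map (λ y → not (∣ x ∣ ==ℕ ∣ y ∣)) xs) ∧ distinctAbs xs

B : ℕ → List (List ℤ)
B n = filterᵇ distinctAbs (words (entries n) n)

neg : List ℤ → ℕ
neg xs = length (filterᵇ (λ x → x <ℤ + 0) xs)

invB : List ℤ → ℕ
invB [] = 0
invB (x ∷ xs) =
  length (filterᵇ (λ y → y <ℤ x) xs)
  ℕ.+ length (filterᵇ (λ y → y <ℤ (ℤ.- x)) xs)
  ℕ.+ (if x <ℤ + 0 then 1 else 0)
  ℕ.+ invB xs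

even : ℕ → Bool
even n = (n % 2) ==ℕ 0

inD : List ℤ → Bool
inD π = even (neg π)

-- snake of type B: 0 < π₁ > π₂ < π₃ > ⋯
mutual
  down : ℤ → List ℤ → Bool
  down x [] = true
  down x (y ∷ ys) = (y <ℤ x) ∧ up y ys

  up : ℤ → List ℤ → Bool
  up x [] = true
  up x (y ∷ ys) = (x <ℤ y) ∧ down y ys

isSnake : List ℤ → Bool
isSnake [] = false
isSnake (x ∷ xs) = (+ 0 <ℤ x) ∧ down x xs

snakes : ℕ → List (List ℤ)
snakes n = filterᵇ isSnake (B n)

count : (List ℤ → Bool) → ℕ → ℕ
count p n = length (filterᵇ p (snakes n))

-- the four counting sequences, with the stated conventions at n = 0
SB+ SB- SD SBD : ℕ → ℕ
SB+ zero = 1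
SB+ (suc n) = count (λ π → even (invB π)) (suc n)
SB- zero = 0
SB- (suc n) = count (λ π → not (even (invB π))) (suc n)
SD zero = 1
SD (suc n) = count inD (suc n)
SBD zero = 0
SBD (suc n) = count (λ π → not (inD π)) (suc n)

PS : Set
PS = ℕ → ℚ

sumTo : ℕ → (ℕ → ℚ) → ℚ
sumTo zero f = f 0
sumTo (suc n) f = sumTo n f ℚ.+ f (suc n)

_⊛_ : PS → PS → PS
(f ⊛ g) n = sumTo n (λ k → f k ℚ.* g (n ∸ k))

_⊝_ : PS → PS → PS
(f ⊝ g) n = f n ℚ.- g n

egf : (ℕ → ℕ) → PS
egf a n = (+ a n / n !) {{n !≢0}}

-- cos x = Σ (-1)^m x^{2m}/(2m)!,  sin x = Σ (-1)^m x^{2m+1}/(2m+1)!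
cosPS : PS
cosPS n with n % 4
... | 0 = (+ 1 / n !) {{n !≢0}}
... | 2 = (ℤ.- + 1 / n !) {{n !≢0}}
... | _ = 0ℚ

sinPS : PS
sinPS n with n % 4
... | 1 = (+ 1 / n !) {{n !≢0}}
... | 3 = (ℤ.- + 1 / n !) {{n !≢0}}
... | _ = 0ℚ

-- Weight π ∈ 𝔅ₙ by (-1)^neg(π) or by (-1)^inv_B(π). Writing π as its first letter a followed by the
-- standardisation of the rest, both weights factor as a sign depending on a times the weight of the rest,
-- so the signed count of alternating permutations with a given first-letter bound satisfies a recurrence
-- in which only the first letters ±1 survive: the signed number of snakes is (cos + sin)⁽ⁿ⁾(0).
-- Hence 2 S_n^{B,±} = S_n ± (cos + sin)⁽ⁿ⁾(0), and likewise for D, where S_n counts all snakes.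
-- The Seidel–Entringer–Arnold triangle of type B writes its entries as binomial transforms of S_n, and
-- its vanishing last entry gives (Σ S_n xⁿ/n!)(cos x - sin x) = 1. Therefore the four series times
-- cos x - sin x are (1 ± (cos x + sin x)(cos x - sin x))/2 = (1 ± cos 2x)/2, i.e. cos² x or sin² x.
-- Everything is proved for the integer sequences n!·(coefficient), multiplied by binomial convolution.

module Submission where

open import Defs
open import Data.Bool using (Bool; true; false; _∧_; _∨_; if_then_else_; not)
open import Data.Nat as ℕ using (ℕ; zero; suc; _∸_; _≤_; _<_; z≤n; s≤s; _!; _%_)
import Data.Nat.Properties as ℕP
open import Data.Nat.Combinatorics using (_C_; nCk+nC[k+1]≡[n+1]C[k+1]; k>n⇒nCk≡0; nCk≡nC[n∸k]; nCk≡n!/k![n-k]!; k![n∸k]!∣n!)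
open import Data.Nat.DivMod using ([m+n]%n≡m%n; m/n*n≡m)
open import Data.Integer as ℤ using (ℤ; +_; -[1+_]; ∣_∣; _+_; _*_; -_; _-_; _^_; 0ℤ; 1ℤ; -1ℤ; +<+; -<+; -<-)
import Data.Integer.Properties as ℤP
open import Data.Integer.Tactic.RingSolver using (solve-∀)
open import Algebra.Properties.CommutativeSemigroup ℤP.+-commutativeSemigroup using () renaming (interchange to +-interchange)
open import Algebra.Properties.CommutativeSemigroup ℕP.+-commutativeSemigroup using () renaming (interchange to ℕ+-interchange)
open import Data.List using (List; []; _∷_; length; map; concatMap; filterᵇ; _++_; applyUpTo; upTo; concat)
open import Data.Bool.ListAction using (and; any)
import Data.List.Properties as Lᴾ
open import Data.Product using (_×_; _,_; proj₁; proj₂)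
open import Data.Sum using (inj₁; inj₂)
open import Data.Empty using (⊥-elim)
open import Relation.Nullary using (Dec; yes; no; ¬_; does)
open import Relation.Nullary.Decidable using (dec-true; dec-false)
open import Relation.Binary.PropositionalEquality
open import Relation.Binary using (tri<; tri≈; tri>)
open import Function using (_∘_; id)
open import Data.Rational as ℚ using (ℚ; 0ℚ; toℚᵘ)
import Data.Rational.Properties as ℚP
open import Data.Rational.Unnormalised as ℚᵘ using (ℚᵘ; mkℚᵘ; *≡*) renaming (_≃_ to _≃ᵘ_)
import Data.Rational.Unnormalised.Properties as ℚᵘP

𝟙 : Bool → ℤ
𝟙 true = 1ℤ
𝟙 false = 0ℤ

sumList : {A : Set} → List A → (A → ℤ) → ℤ
sumList [] f = 0ℤ
sumList (x ∷ xs) f = f x + sumList xs f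

private variable A A′ : Set

sumList-cong : ∀ (xs : List A) {f g : A → ℤ} → (∀ x → f x ≡ g x) → sumList xs f ≡ sumList xs g
sumList-cong [] e = refl
sumList-cong (x ∷ xs) e = cong₂ _+_ (e x) (sumList-cong xs e)

sumList-++ : ∀ (xs ys : List A) f → sumList (xs ++ ys) f ≡ sumList xs f + sumList ys f
sumList-++ [] ys f = sym (ℤP.+-identityˡ _)
sumList-++ (x ∷ xs) ys f rewrite sumList-++ xs ys f = sym (ℤP.+-assoc (f x) _ _)

sumList-map : (g : A → A′) (xs : List A) (f : A′ → ℤ) → sumList (map g xs) f ≡ sumList xs (f ∘ g)
sumList-map g [] f = refl
sumList-map g (x ∷ xs) f = cong (_+_ (f (g x))) (sumList-map g xs f)

sumList-concatMap : (h : A → List A′) (xs : List A) (f : A′ → ℤ) →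
                    sumList (concatMap h xs) f ≡ sumList xs (λ x → sumList (h x) f)
sumList-concatMap h [] f = refl
sumList-concatMap h (x ∷ xs) f =
  trans (sumList-++ (h x) (concat (map h xs)) f) (cong (_+_ (sumList (h x) f)) (sumList-concatMap h xs f))

sumList-zero : ∀ (xs : List A) → sumList xs (λ _ → 0ℤ) ≡ 0ℤ
sumList-zero [] = refl
sumList-zero (x ∷ xs) = trans (ℤP.+-identityˡ _) (sumList-zero xs)

sumList-+ : ∀ (xs : List A) f g → sumList xs (λ x → f x + g x) ≡ sumList xs f + sumList xs g
sumList-+ [] f g = refl
sumList-+ (x ∷ xs) f g rewrite sumList-+ xs f g = +-interchange (f x) (g x) (sumList xs f) (sumList xs g)

sumList-* : ∀ (xs : List A) c f → sumList xs (λ x → c * f x) ≡ c * sumList xs f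
sumList-* [] c f = sym (ℤP.*-zeroʳ c)
sumList-* (x ∷ xs) c f rewrite sumList-* xs c f = sym (ℤP.*-distribˡ-+ c (f x) _)

sumList-swap : (xs : List A) (ys : List A′) (f : A → A′ → ℤ) →
               sumList xs (λ x → sumList ys (f x)) ≡ sumList ys (λ y → sumList xs (λ x → f x y))
sumList-swap [] ys f = sym (sumList-zero ys)
sumList-swap (x ∷ xs) ys f rewrite sumList-swap xs ys f = sym (sumList-+ ys (f x) _)

sumList-filter : ∀ (p : A → Bool) xs f → sumList (filterᵇ p xs) f ≡ sumList xs (λ x → if p x then f x else 0ℤ)
sumList-filter p [] f = refl
sumList-filter p (x ∷ xs) f with p x
... | true = cong (_+_ (f x)) (sumList-filter p xs f)
... | false = trans (sumList-filter p xs f) (sym (ℤP.+-identityˡ _))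

length-filter : ∀ (p : A → Bool) xs → + length (filterᵇ p xs) ≡ sumList xs (𝟙 ∘ p)
length-filter p [] = refl
length-filter p (x ∷ xs) with p x
... | true = trans (ℤP.pos-+ 1 (length (filterᵇ p xs))) (cong (_+_ 1ℤ) (length-filter p xs))
... | false = trans (length-filter p xs) (sym (ℤP.+-identityˡ _))

sumBelow : ℕ → (ℕ → ℤ) → ℤ
sumBelow zero f = 0ℤ
sumBelow (suc n) f = sumBelow n f + f n

sumBelow-cong : ∀ n {f g : ℕ → ℤ} → (∀ k → k < n → f k ≡ g k) → sumBelow n f ≡ sumBelow n g
sumBelow-cong zero e = refl
sumBelow-cong (suc n) e = cong₂ _+_ (sumBelow-cong n (λ k k<n → e k (ℕP.m<n⇒m<1+n k<n))) (e n ℕP.≤-refl)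

sumBelow-zero : ∀ n (f : ℕ → ℤ) → (∀ k → k < n → f k ≡ 0ℤ) → sumBelow n f ≡ 0ℤ
sumBelow-zero n f h = trans (sumBelow-cong n h) (zeros n)
  where
  zeros : ∀ n → sumBelow n (λ _ → 0ℤ) ≡ 0ℤ
  zeros zero = refl
  zeros (suc n) = trans (ℤP.+-identityʳ _) (zeros n)

sumBelow-suc : ∀ n (f : ℕ → ℤ) → sumBelow (suc n) f ≡ f 0 + sumBelow n (f ∘ suc)
sumBelow-suc zero f = trans (ℤP.+-identityˡ (f 0)) (sym (ℤP.+-identityʳ (f 0)))
sumBelow-suc (suc n) f rewrite sumBelow-suc n f = ℤP.+-assoc (f 0) _ _

sumBelow-+ : ∀ n (f g : ℕ → ℤ) → sumBelow n (λ k → f k + g k) ≡ sumBelow n f + sumBelow n g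
sumBelow-+ zero f g = refl
sumBelow-+ (suc n) f g rewrite sumBelow-+ n f g = +-interchange (sumBelow n f) (sumBelow n g) (f n) (g n)

sumBelow-* : ∀ n c (f : ℕ → ℤ) → sumBelow n (λ k → c * f k) ≡ c * sumBelow n f
sumBelow-* zero c f = sym (ℤP.*-zeroʳ c)
sumBelow-* (suc n) c f rewrite sumBelow-* n c f = sym (ℤP.*-distribˡ-+ c (sumBelow n f) (f n))

sumBelow-neg : ∀ n (f : ℕ → ℤ) → sumBelow n (λ k → - f k) ≡ - sumBelow n f
sumBelow-neg zero f = refl
sumBelow-neg (suc n) f rewrite sumBelow-neg n f = sym (ℤP.neg-distrib-+ (sumBelow n f) (f n))

sumBelow-reverse : ∀ n (f : ℕ → ℤ) → sumBelow n f ≡ sumBelow n (λ k → f (n ∸ suc k))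
sumBelow-reverse zero f = refl
sumBelow-reverse (suc n) f =
  trans (cong (_+ f n) (sumBelow-reverse n f))
        (trans (ℤP.+-comm _ (f n)) (sym (sumBelow-suc n (λ k → f (suc n ∸ suc k)))))

sumList-applyUpTo : ∀ n {A : Set} (g : ℕ → A) (f : A → ℤ) → sumList (applyUpTo g n) f ≡ sumBelow n (f ∘ g)
sumList-applyUpTo zero g f = refl
sumList-applyUpTo (suc n) g f =
  trans (cong (_+_ (f (g 0))) (sumList-applyUpTo n (g ∘ suc) f)) (sym (sumBelow-suc n (f ∘ g)))

punchIn : ℕ → ℕ → ℕ
punchIn zero k = suc k
punchIn (suc i) zero = zero
punchIn (suc i) (suc k) = suc (punchIn i k)

punchIn-≥ : ∀ {i k} → i ≤ k → punchIn i k ≡ suc k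
punchIn-≥ {zero} _ = refl
punchIn-≥ {suc i} (s≤s i≤k) = cong suc (punchIn-≥ i≤k)

punchIn-< : ∀ {i k} → k < i → punchIn i k ≡ k
punchIn-< {suc i} {zero} _ = refl
punchIn-< {suc i} {suc k} (s≤s k<i) = cong suc (punchIn-< k<i)

≤-punchIn : ∀ i k → k ≤ punchIn i k
≤-punchIn zero k = ℕP.n≤1+n k
≤-punchIn (suc i) zero = z≤n
≤-punchIn (suc i) (suc k) = s≤s (≤-punchIn i k)

punchIn-mono-< : ∀ i {k l} → k < l → punchIn i k < punchIn i l
punchIn-mono-< zero k<l = s≤s k<l
punchIn-mono-< (suc i) {zero} {suc l} _ = s≤s z≤n
punchIn-mono-< (suc i) {suc k} {suc l} (s≤s k<l) = s≤s (punchIn-mono-< i k<l)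

punchIn-cancel-< : ∀ i {k l} → punchIn i k < punchIn i l → k < l
punchIn-cancel-< zero (s≤s k<l) = k<l
punchIn-cancel-< (suc i) {zero} {suc l} _ = s≤s z≤n
punchIn-cancel-< (suc i) {suc k} {suc l} (s≤s p) = s≤s (punchIn-cancel-< i p)

punchIn-injective : ∀ i {k l} → punchIn i k ≡ punchIn i l → k ≡ l
punchIn-injective zero refl = refl
punchIn-injective (suc i) {zero} {zero} _ = refl
punchIn-injective (suc i) {suc k} {suc l} e = cong suc (punchIn-injective i (ℕP.suc-injective e))

punchIn≢ : ∀ i k → punchIn i k ≢ i
punchIn≢ zero k ()
punchIn≢ (suc i) (suc k) e = punchIn≢ i k (ℕP.suc-injective e)

punchIn<⇒< : ∀ i k → punchIn i k < i → k < i
punchIn<⇒< i k = ℕP.≤-<-trans (≤-punchIn i k)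

<⇒punchIn< : ∀ i k → k < i → punchIn i k < i
<⇒punchIn< i k k<i = subst (_< i) (sym (punchIn-< k<i)) k<i

<punchIn⇒≤ : ∀ i k → i < punchIn i k → i ≤ k
<punchIn⇒≤ zero k _ = z≤n
<punchIn⇒≤ (suc i) (suc k) (s≤s p) = s≤s (<punchIn⇒≤ i k p)

≤⇒<punchIn : ∀ i k → i ≤ k → i < punchIn i k
≤⇒<punchIn i k i≤k = subst (i <_) (sym (punchIn-≥ i≤k)) (s≤s i≤k)

-- A threshold j at or below the gap, resp. above it, sees the same entries before and after insertion.
punchIn-<-below : ∀ {i j} m → j ≤ i → punchIn i m < j → m < j
punchIn-<-below {i} m j≤i = ℕP.≤-<-trans (≤-punchIn i m)

<-punchIn-below : ∀ {i j} m → j ≤ i → m < j → punchIn i m < j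
<-punchIn-below {i} m j≤i m<j = subst (_< _) (sym (punchIn-< (ℕP.<-≤-trans m<j j≤i))) m<j

punchIn-<-above : ∀ {i j} m → i ≤ j → punchIn i m < suc j → m < j
punchIn-<-above {i} m i≤j p with m ℕ.<? i
... | yes m<i = ℕP.<-≤-trans m<i i≤j
... | no m≮i = ℕP.≤-pred (subst (_< suc _) (punchIn-≥ (ℕP.≮⇒≥ m≮i)) p)

<-punchIn-above : ∀ {i j} m → i ≤ j → m < j → punchIn i m < suc j
<-punchIn-above {i} m i≤j m<j with m ℕ.<? i
... | yes m<i = subst (_< suc _) (sym (punchIn-< m<i)) (ℕP.m<n⇒m<1+n m<j)
... | no m≮i = subst (_< suc _) (sym (punchIn-≥ (ℕP.≮⇒≥ m≮i))) (s≤s m<j)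

sumBelow-punchIn : ∀ n i → i ≤ n → (f : ℕ → ℤ) → sumBelow (suc n) f ≡ f i + sumBelow n (f ∘ punchIn i)
sumBelow-punchIn zero zero _ f = trans (ℤP.+-identityˡ (f 0)) (sym (ℤP.+-identityʳ (f 0)))
sumBelow-punchIn (suc n) i i≤1+n f with ℕP.m≤n⇒m<n∨m≡n i≤1+n
... | inj₂ refl =
  trans (cong (_+ f (suc n)) (sumBelow-cong (suc n) (λ k k<i → cong f (sym (punchIn-< k<i)))))
        (ℤP.+-comm _ (f (suc n)))
... | inj₁ (s≤s i≤n) = begin
  sumBelow (suc n) f + f (suc n)                         ≡⟨ cong (_+ f (suc n)) (sumBelow-punchIn n i i≤n f) ⟩
  (f i + sumBelow n (f ∘ punchIn i)) + f (suc n)          ≡⟨ ℤP.+-assoc (f i) _ _ ⟩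
  f i + (sumBelow n (f ∘ punchIn i) + f (suc n))          ≡⟨ cong (λ k → f i + (sumBelow n (f ∘ punchIn i) + f k)) (sym (punchIn-≥ i≤n)) ⟩
  f i + sumBelow (suc n) (f ∘ punchIn i)                  ∎
  where open ≡-Reasoning

sumList-entries : ∀ n (H : ℤ → ℤ) → sumList (entries n) H ≡ sumBelow n (λ k → H (+ suc k)) + sumBelow n (λ k → H -[1+ k ])
sumList-entries n H = trans (sumList-++ (map (λ k → + suc k) (upTo n)) _ H)
  (cong₂ _+_ (trans (sumList-map _ (upTo n) H) (sumList-applyUpTo n id _))
             (trans (sumList-map _ (upTo n) H) (sumList-applyUpTo n id _)))

sumList-entries-cong : ∀ n {F G : ℤ → ℤ} →
  (∀ k → k < n → F (+ suc k) ≡ G (+ suc k)) → (∀ k → k < n → F -[1+ k ] ≡ G -[1+ k ]) →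
  sumList (entries n) F ≡ sumList (entries n) G
sumList-entries-cong n {F} {G} e+ e- =
  trans (sumList-entries n F) (trans (cong₂ _+_ (sumBelow-cong n e+) (sumBelow-cong n e-)) (sym (sumList-entries n G)))

sumList-entries-±1 : ∀ n (g : ℤ → ℤ) → (∀ k → k < n → g (+ suc (suc k)) ≡ 0ℤ) → (∀ k → k < n → g -[1+ suc k ] ≡ 0ℤ) →
  sumList (entries (suc n)) g ≡ g (+ 1) + g -[1+ 0 ]
sumList-entries-±1 n g vanish+ vanish- = begin
  sumList (entries (suc n)) g
    ≡⟨ sumList-entries (suc n) g ⟩
  sumBelow (suc n) (λ k → g (+ suc k)) + sumBelow (suc n) (λ k → g -[1+ k ])
    ≡⟨ cong₂ _+_ (sumBelow-suc n (λ k → g (+ suc k))) (sumBelow-suc n (λ k → g -[1+ k ])) ⟩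
  (g (+ 1) + sumBelow n (λ k → g (+ suc (suc k)))) + (g -[1+ 0 ] + sumBelow n (λ k → g -[1+ suc k ]))
    ≡⟨ cong₂ (λ x y → (g (+ 1) + x) + (g -[1+ 0 ] + y)) (sumBelow-zero n _ vanish+) (sumBelow-zero n _ vanish-) ⟩
  (g (+ 1) + 0ℤ) + (g -[1+ 0 ] + 0ℤ)
    ≡⟨ cong₂ _+_ (ℤP.+-identityʳ (g (+ 1))) (ℤP.+-identityʳ (g -[1+ 0 ])) ⟩
  g (+ 1) + g -[1+ 0 ] ∎
  where open ≡-Reasoning

does-⇔ : ∀ {P Q : Set} (p : Dec P) (q : Dec Q) → (P → Q) → (Q → P) → does p ≡ does q
does-⇔ (yes p) q f g = sym (dec-true q (f p))
does-⇔ (no ¬p) q f g = sym (dec-false q (¬p ∘ g))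

pos<ᵇpos-⇔ : ∀ m n m′ n′ → (m < n → m′ < n′) → (m′ < n′ → m < n) → (+ m <ℤ + n) ≡ (+ m′ <ℤ + n′)
pos<ᵇpos-⇔ m n m′ n′ f g =
  does-⇔ (+ m ℤ.<? + n) (+ m′ ℤ.<? + n′) (λ h → +<+ (f (ℤP.drop‿+<+ h))) (λ h → +<+ (g (ℤP.drop‿+<+ h)))

neg<ᵇneg-⇔ : ∀ m n m′ n′ → (n < m → n′ < m′) → (n′ < m′ → n < m) → (-[1+ m ] <ℤ -[1+ n ]) ≡ (-[1+ m′ ] <ℤ -[1+ n′ ])
neg<ᵇneg-⇔ m n m′ n′ f g =
  does-⇔ (-[1+ m ] ℤ.<? -[1+ n ]) (-[1+ m′ ] ℤ.<? -[1+ n′ ]) (λ h → -<- (f (ℤP.drop‿-<- h))) (λ h → -<- (g (ℤP.drop‿-<- h)))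

pos<ᵇpos : ∀ {m n} → m < n → (+ m <ℤ + n) ≡ true
pos<ᵇpos {m} {n} h = dec-true (+ m ℤ.<? + n) (+<+ h)

pos≮ᵇpos : ∀ {m n} → ¬ m < n → (+ m <ℤ + n) ≡ false
pos≮ᵇpos {m} {n} h = dec-false (+ m ℤ.<? + n) (h ∘ ℤP.drop‿+<+)

neg<ᵇneg : ∀ {m n} → n < m → (-[1+ m ] <ℤ -[1+ n ]) ≡ true
neg<ᵇneg {m} {n} h = dec-true (-[1+ m ] ℤ.<? -[1+ n ]) (-<- h)

neg≮ᵇneg : ∀ {m n} → ¬ n < m → (-[1+ m ] <ℤ -[1+ n ]) ≡ false
neg≮ᵇneg {m} {n} h = dec-false (-[1+ m ] ℤ.<? -[1+ n ]) (h ∘ ℤP.drop‿-<-)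

neg<ᵇpos : ∀ m n → (-[1+ m ] <ℤ + n) ≡ true
neg<ᵇpos m n = dec-true (-[1+ m ] ℤ.<? + n) -<+

pos≮ᵇneg : ∀ m n → (+ m <ℤ -[1+ n ]) ≡ false
pos≮ᵇneg m n = dec-false (+ m ℤ.<? -[1+ n ]) (λ ())

-- Inserting a gap at absolute value i + 1: the order-preserving, odd embedding that
-- turns a signed permutation of n letters into one of n + 1 letters avoiding ±(i + 1).

punchInℤ : ℕ → ℤ → ℤ
punchInℤ i (+ zero) = + zero
punchInℤ i (+ suc k) = + suc (punchIn i k)
punchInℤ i -[1+ k ] = -[1+ punchIn i k ]

punchInℤ-<ᵇ : ∀ i y z → (punchInℤ i y <ℤ punchInℤ i z) ≡ (y <ℤ z)
punchInℤ-<ᵇ i (+ zero) (+ zero) = refl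
punchInℤ-<ᵇ i (+ zero) (+ suc l) = pos<ᵇpos-⇔ 0 (suc (punchIn i l)) 0 (suc l) (λ _ → s≤s z≤n) (λ _ → s≤s z≤n)
punchInℤ-<ᵇ i (+ suc k) (+ zero) = pos<ᵇpos-⇔ (suc (punchIn i k)) 0 (suc k) 0 (λ ()) (λ ())
punchInℤ-<ᵇ i (+ suc k) (+ suc l) =
  pos<ᵇpos-⇔ (suc (punchIn i k)) (suc (punchIn i l)) (suc k) (suc l)
             (λ { (s≤s h) → s≤s (punchIn-cancel-< i h) }) (λ { (s≤s h) → s≤s (punchIn-mono-< i h) })
punchInℤ-<ᵇ i (+ zero) -[1+ l ] = trans (pos≮ᵇneg 0 (punchIn i l)) (sym (pos≮ᵇneg 0 l))
punchInℤ-<ᵇ i (+ suc k) -[1+ l ] = trans (pos≮ᵇneg (suc (punchIn i k)) (punchIn i l)) (sym (pos≮ᵇneg (suc k) l))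
punchInℤ-<ᵇ i -[1+ k ] (+ zero) = trans (neg<ᵇpos (punchIn i k) 0) (sym (neg<ᵇpos k 0))
punchInℤ-<ᵇ i -[1+ k ] (+ suc l) = trans (neg<ᵇpos (punchIn i k) (suc (punchIn i l))) (sym (neg<ᵇpos k (suc l)))
punchInℤ-<ᵇ i -[1+ k ] -[1+ l ] = neg<ᵇneg-⇔ (punchIn i k) (punchIn i l) k l (punchIn-cancel-< i) (punchIn-mono-< i)

punchInℤ-<ᵇ-pos : ∀ i y → (punchInℤ i y <ℤ + suc i) ≡ (y <ℤ + suc i)
punchInℤ-<ᵇ-pos i (+ zero) = refl
punchInℤ-<ᵇ-pos i (+ suc k) =
  pos<ᵇpos-⇔ (suc (punchIn i k)) (suc i) (suc k) (suc i) (λ { (s≤s h) → s≤s (punchIn<⇒< i k h) }) (λ { (s≤s h) → s≤s (<⇒punchIn< i k h) })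
punchInℤ-<ᵇ-pos i -[1+ k ] = trans (neg<ᵇpos (punchIn i k) (suc i)) (sym (neg<ᵇpos k (suc i)))

punchInℤ-<ᵇ-neg : ∀ i y → (punchInℤ i y <ℤ -[1+ i ]) ≡ (y <ℤ - (+ i))
punchInℤ-<ᵇ-neg zero (+ zero) = refl
punchInℤ-<ᵇ-neg (suc i) (+ zero) = refl
punchInℤ-<ᵇ-neg zero (+ suc k) = trans (pos≮ᵇneg (suc (punchIn 0 k)) 0) (sym (pos≮ᵇpos {suc k} {0} (λ ())))
punchInℤ-<ᵇ-neg (suc i) (+ suc k) = trans (pos≮ᵇneg (suc (punchIn (suc i) k)) (suc i)) (sym (pos≮ᵇneg (suc k) i))
punchInℤ-<ᵇ-neg zero -[1+ k ] = trans (neg<ᵇneg {punchIn 0 k} {0} (s≤s z≤n)) (sym (neg<ᵇpos k 0))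
punchInℤ-<ᵇ-neg (suc i) -[1+ k ] = neg<ᵇneg-⇔ (punchIn (suc i) k) (suc i) k i (<punchIn⇒≤ (suc i) k) (≤⇒<punchIn (suc i) k)

pos-<ᵇ-punchInℤ : ∀ i y → (+ suc i <ℤ punchInℤ i y) ≡ (+ i <ℤ y)
pos-<ᵇ-punchInℤ i (+ zero) = pos<ᵇpos-⇔ (suc i) 0 i 0 (λ ()) (λ ())
pos-<ᵇ-punchInℤ i (+ suc k) =
  pos<ᵇpos-⇔ (suc i) (suc (punchIn i k)) i (suc k) (λ { (s≤s h) → s≤s (<punchIn⇒≤ i k h) }) (λ { (s≤s h) → s≤s (≤⇒<punchIn i k h) })
pos-<ᵇ-punchInℤ i -[1+ k ] = trans (pos≮ᵇneg (suc i) (punchIn i k)) (sym (pos≮ᵇneg i k))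

neg-<ᵇ-punchInℤ : ∀ i y → (-[1+ i ] <ℤ punchInℤ i y) ≡ (-[1+ i ] <ℤ y)
neg-<ᵇ-punchInℤ i (+ zero) = refl
neg-<ᵇ-punchInℤ i (+ suc k) = trans (neg<ᵇpos i (suc (punchIn i k))) (sym (neg<ᵇpos i (suc k)))
neg-<ᵇ-punchInℤ i -[1+ k ] = neg<ᵇneg-⇔ i (punchIn i k) i k (punchIn<⇒< i k) (<⇒punchIn< i k)

punchInℤ-<ᵇ-0 : ∀ i y → (punchInℤ i y <ℤ + 0) ≡ (y <ℤ + 0)
punchInℤ-<ᵇ-0 i (+ zero) = refl
punchInℤ-<ᵇ-0 i (+ suc k) = pos<ᵇpos-⇔ (suc (punchIn i k)) 0 (suc k) 0 (λ ()) (λ ())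
punchInℤ-<ᵇ-0 i -[1+ k ] = trans (neg<ᵇpos (punchIn i k) 0) (sym (neg<ᵇpos k 0))

neg-punchInℤ : ∀ i y → - punchInℤ i y ≡ punchInℤ i (- y)
neg-punchInℤ i (+ zero) = refl
neg-punchInℤ i (+ suc k) = refl
neg-punchInℤ i -[1+ k ] = refl

∣punchInℤ∣ : ∀ i y → ∣ punchInℤ i y ∣ ≡ punchIn (suc i) ∣ y ∣
∣punchInℤ∣ i (+ zero) = refl
∣punchInℤ∣ i (+ suc k) = refl
∣punchInℤ∣ i -[1+ k ] = refl

sumB : ℕ → (List ℤ → ℤ) → ℤ
sumB n F = sumList (B n) F

sumB-cong : ∀ n {F G : List ℤ → ℤ} → (∀ π → F π ≡ G π) → sumB n F ≡ sumB n G
sumB-cong n = sumList-cong (B n)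

onDistinct : (List ℤ → ℤ) → List ℤ → ℤ
onDistinct F w = if distinctAbs w then F w else 0ℤ

sumB-words : ∀ n F → sumB n F ≡ sumList (words (entries n) n) (onDistinct F)
sumB-words n F = sumList-filter distinctAbs (words (entries n) n) F

sumList-words-suc : ∀ (A : List ℤ) k (G : List ℤ → ℤ) →
  sumList (words A (suc k)) G ≡ sumList A (λ a → sumList (words A k) (λ w → G (a ∷ w)))
sumList-words-suc A k G = trans (sumList-concatMap _ (words A k) G)
  (trans (sumList-cong (words A k) (λ w → sumList-map (_∷ w) A G)) (sumList-swap (words A k) A _))

sumList-words-transfer : ∀ (A A′ : List ℤ) (h : ℤ → ℤ) (bad : ℤ → Bool) →
  (∀ (H : ℤ → ℤ) → (∀ x → bad x ≡ true → H x ≡ 0ℤ) → sumList A H ≡ sumList A′ (H ∘ h)) →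
  ∀ k (G : List ℤ → ℤ) → (∀ w → any bad w ≡ true → G w ≡ 0ℤ) →
  sumList (words A k) G ≡ sumList (words A′ k) (G ∘ map h)
sumList-words-transfer A A′ h bad sumA zero G vanish = refl
sumList-words-transfer A A′ h bad sumA (suc k) G vanish = begin
  sumList (words A (suc k)) G
    ≡⟨ sumList-words-suc A k G ⟩
  sumList A (λ a → sumList (words A k) (λ w → G (a ∷ w)))
    ≡⟨ sumList-cong A (λ a → sumList-words-transfer A A′ h bad sumA k (λ w → G (a ∷ w))
                                (λ w bad∈w → vanish (a ∷ w) (∨-introʳ (bad a) bad∈w))) ⟩
  sumList A (λ a → sumList (words A′ k) (λ ρ → G (a ∷ map h ρ)))
    ≡⟨ sumA _ (λ x bad-x → trans (sumList-cong (words A′ k) (λ ρ → vanish (x ∷ map h ρ) (∨-introˡ bad-x)))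
                                 (sumList-zero (words A′ k))) ⟩
  sumList A′ (λ b → sumList (words A′ k) (λ ρ → G (h b ∷ map h ρ)))
    ≡⟨ sym (sumList-words-suc A′ k (G ∘ map h)) ⟩
  sumList (words A′ (suc k)) (G ∘ map h) ∎
  where
  open ≡-Reasoning
  ∨-introʳ : ∀ b {c} → c ≡ true → b ∨ c ≡ true
  ∨-introʳ true _ = refl
  ∨-introʳ false c = c
  ∨-introˡ : ∀ {b c} → b ≡ true → b ∨ c ≡ true
  ∨-introˡ refl = refl

sumList-entries-punchIn : ∀ n i → i ≤ n → (H : ℤ → ℤ) → H (+ suc i) ≡ 0ℤ → H -[1+ i ] ≡ 0ℤ →
  sumList (entries (suc n)) H ≡ sumList (entries n) (H ∘ punchInℤ i)
sumList-entries-punchIn n i i≤n H H+ H- = begin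
  sumList (entries (suc n)) H
    ≡⟨ sumList-entries (suc n) H ⟩
  sumBelow (suc n) (λ k → H (+ suc k)) + sumBelow (suc n) (λ k → H -[1+ k ])
    ≡⟨ cong₂ _+_ (sumBelow-punchIn n i i≤n (λ k → H (+ suc k))) (sumBelow-punchIn n i i≤n (λ k → H -[1+ k ])) ⟩
  (H (+ suc i) + S+) + (H -[1+ i ] + S-)
    ≡⟨ cong₂ (λ x y → (x + S+) + (y + S-)) H+ H- ⟩
  (0ℤ + S+) + (0ℤ + S-)
    ≡⟨ cong₂ _+_ (ℤP.+-identityˡ S+) (ℤP.+-identityˡ S-) ⟩
  S+ + S-
    ≡⟨ sym (sumList-entries n (H ∘ punchInℤ i)) ⟩
  sumList (entries n) (H ∘ punchInℤ i) ∎
  where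
  open ≡-Reasoning
  S+ = sumBelow n (λ k → H (+ suc (punchIn i k)))
  S- = sumBelow n (λ k → H -[1+ punchIn i k ])

==ℕ-true : ∀ {m n} → m ≡ n → (m ==ℕ n) ≡ true
==ℕ-true {m} {n} = dec-true (m ℕ.≟ n)

distinctAbs-map : ∀ (f : ℤ → ℤ) → (∀ x y → (∣ f x ∣ ==ℕ ∣ f y ∣) ≡ (∣ x ∣ ==ℕ ∣ y ∣)) →
  ∀ ρ → distinctAbs (map f ρ) ≡ distinctAbs ρ
distinctAbs-map f f-abs [] = refl
distinctAbs-map f f-abs (x ∷ ρ) =
  cong₂ _∧_ (cong and (trans (sym (Lᴾ.map-∘ ρ)) (Lᴾ.map-cong (λ y → cong not (f-abs x y)) ρ)))
            (distinctAbs-map f f-abs ρ)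

distinctAbs-punchInℤ : ∀ i ρ → distinctAbs (map (punchInℤ i) ρ) ≡ distinctAbs ρ
distinctAbs-punchInℤ i = distinctAbs-map (punchInℤ i) λ x y →
  trans (cong₂ _==ℕ_ (∣punchInℤ∣ i x) (∣punchInℤ∣ i y))
        (does-⇔ (_ ℕ.≟ _) (∣ x ∣ ℕ.≟ ∣ y ∣) (punchIn-injective (suc i)) (cong (punchIn (suc i))))

distinctAbs-neg : ∀ ρ → distinctAbs (map -_ ρ) ≡ distinctAbs ρ
distinctAbs-neg = distinctAbs-map -_ λ x y → cong₂ _==ℕ_ (ℤP.∣-i∣≡∣i∣ x) (ℤP.∣-i∣≡∣i∣ y)

-- Once ∣ a ∣ = i + 1 is used, the remaining n letters, relabelled by punchInℤ i, range over 𝔅ₙ.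
sumList-words-after : ∀ n i → i ≤ n → (a : ℤ) → ∣ a ∣ ≡ suc i → (F : List ℤ → ℤ) →
  sumList (words (entries (suc n)) n) (λ w → onDistinct F (a ∷ w)) ≡ sumB n (λ ρ → F (a ∷ map (punchInℤ i) ρ))
sumList-words-after n i i≤n a ∣a∣ F = begin
  sumList (words (entries (suc n)) n) (λ w → onDistinct F (a ∷ w))
    ≡⟨ sumList-words-transfer (entries (suc n)) (entries n) (punchInℤ i) (λ x → ∣ a ∣ ==ℕ ∣ x ∣)
         (λ H vanish → sumList-entries-punchIn n i i≤n H (vanish _ same-abs) (vanish _ same-abs)) n _ repeat ⟩
  sumList (words (entries n) n) (λ ρ → onDistinct F (a ∷ map (punchInℤ i) ρ))
    ≡⟨ sumList-cong (words (entries n) n) fresh ⟩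
  sumList (words (entries n) n) (onDistinct (λ ρ → F (a ∷ map (punchInℤ i) ρ)))
    ≡⟨ sym (sumB-words n _) ⟩
  sumB n (λ ρ → F (a ∷ map (punchInℤ i) ρ)) ∎
  where
  open ≡-Reasoning
  same-abs : (∣ a ∣ ==ℕ suc i) ≡ true
  same-abs = ==ℕ-true ∣a∣
  clash : ∀ w → any (λ x → ∣ a ∣ ==ℕ ∣ x ∣) w ≡ true → and (map (λ y → not (∣ a ∣ ==ℕ ∣ y ∣)) w) ≡ false
  clash (x ∷ w) h with ∣ a ∣ ==ℕ ∣ x ∣
  ... | true = refl
  ... | false = clash w h
  repeat : ∀ w → any (λ x → ∣ a ∣ ==ℕ ∣ x ∣) w ≡ true → onDistinct F (a ∷ w) ≡ 0ℤ
  repeat w a∈w rewrite clash w a∈w = refl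
  avoids : ∀ ρ → and (map (λ y → not (suc i ==ℕ ∣ y ∣)) (map (punchInℤ i) ρ)) ≡ true
  avoids [] = refl
  avoids (y ∷ ρ) rewrite ∣punchInℤ∣ i y
                       | dec-false (suc i ℕ.≟ punchIn (suc i) ∣ y ∣) (punchIn≢ (suc i) ∣ y ∣ ∘ sym) = avoids ρ
  fresh : ∀ ρ → onDistinct F (a ∷ map (punchInℤ i) ρ) ≡ onDistinct (λ ρ → F (a ∷ map (punchInℤ i) ρ)) ρ
  fresh ρ rewrite ∣a∣ | avoids ρ | distinctAbs-punchInℤ i ρ = refl

-- Every element of 𝔅ₙ₊₁ is a ◁ ρ for exactly one letter a and one ρ ∈ 𝔅ₙ.
infixr 5 _◁_
_◁_ : ℤ → List ℤ → List ℤ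
a ◁ ρ = a ∷ map (punchInℤ (∣ a ∣ ∸ 1)) ρ

sumB-suc : ∀ n F → sumB (suc n) F ≡ sumList (entries (suc n)) (λ a → sumB n (λ ρ → F (a ◁ ρ)))
sumB-suc n F = begin
  sumB (suc n) F
    ≡⟨ sumB-words (suc n) F ⟩
  sumList (words (entries (suc n)) (suc n)) (onDistinct F)
    ≡⟨ sumList-words-suc (entries (suc n)) n (onDistinct F) ⟩
  sumList (entries (suc n)) (λ a → sumList (words (entries (suc n)) n) (λ w → onDistinct F (a ∷ w)))
    ≡⟨ sumList-entries-cong (suc n) {F = λ a → sumList (words (entries (suc n)) n) (λ w → onDistinct F (a ∷ w))}
         {G = λ a → sumB n (λ ρ → F (a ◁ ρ))}
         (λ k k<1+n → sumList-words-after n k (ℕP.≤-pred k<1+n) (+ suc k) refl F)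
         (λ k k<1+n → sumList-words-after n k (ℕP.≤-pred k<1+n) -[1+ k ] refl F) ⟩
  sumList (entries (suc n)) (λ a → sumB n (λ ρ → F (a ◁ ρ))) ∎
  where open ≡-Reasoning

sumB-neg : ∀ n F → sumB n F ≡ sumB n (F ∘ map (-_))
sumB-neg n F = begin
  sumB n F
    ≡⟨ sumB-words n F ⟩
  sumList (words (entries n) n) (onDistinct F)
    ≡⟨ sumList-words-transfer (entries n) (entries n) -_ (λ _ → false) (λ H _ → entries-neg H) n (onDistinct F) (λ w → ⊥-elim ∘ none w) ⟩
  sumList (words (entries n) n) (onDistinct F ∘ map (-_))
    ≡⟨ sumList-cong (words (entries n) n) (λ ρ → cong (λ b → if b then F (map -_ ρ) else 0ℤ) (distinctAbs-neg ρ)) ⟩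
  sumList (words (entries n) n) (onDistinct (F ∘ map (-_)))
    ≡⟨ sym (sumB-words n _) ⟩
  sumB n (F ∘ map (-_)) ∎
  where
  open ≡-Reasoning
  none : ∀ w → any (λ _ → false) w ≢ true
  none (x ∷ w) = none w
  entries-neg : ∀ H → sumList (entries n) H ≡ sumList (entries n) (H ∘ -_)
  entries-neg H = trans (sumList-entries n H)
    (trans (ℤP.+-comm (sumBelow n (λ k → H (+ suc k))) _) (sym (sumList-entries n (H ∘ -_))))

up-down-punchInℤ : ∀ i x xs → (up (punchInℤ i x) (map (punchInℤ i) xs) ≡ up x xs)
                             × (down (punchInℤ i x) (map (punchInℤ i) xs) ≡ down x xs)
up-down-punchInℤ i x [] = refl , refl
up-down-punchInℤ i x (y ∷ ys) =
  cong₂ _∧_ (punchInℤ-<ᵇ i x y) (proj₂ (up-down-punchInℤ i y ys)) ,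
  cong₂ _∧_ (punchInℤ-<ᵇ i y x) (proj₁ (up-down-punchInℤ i y ys))

down-punchInℤ-pos : ∀ i ρ → down (+ suc i) (map (punchInℤ i) ρ) ≡ down (+ suc i) ρ
down-punchInℤ-pos i [] = refl
down-punchInℤ-pos i (y ∷ ys) = cong₂ _∧_ (punchInℤ-<ᵇ-pos i y) (proj₁ (up-down-punchInℤ i y ys))

down-punchInℤ-neg : ∀ i ρ → down -[1+ i ] (map (punchInℤ i) ρ) ≡ down (- (+ i)) ρ
down-punchInℤ-neg i [] = refl
down-punchInℤ-neg i (y ∷ ys) = cong₂ _∧_ (punchInℤ-<ᵇ-neg i y) (proj₁ (up-down-punchInℤ i y ys))

up-punchInℤ-pos : ∀ i ρ → up (+ suc i) (map (punchInℤ i) ρ) ≡ up (+ i) ρ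
up-punchInℤ-pos i [] = refl
up-punchInℤ-pos i (y ∷ ys) = cong₂ _∧_ (pos-<ᵇ-punchInℤ i y) (proj₂ (up-down-punchInℤ i y ys))

up-punchInℤ-neg : ∀ i ρ → up -[1+ i ] (map (punchInℤ i) ρ) ≡ up -[1+ i ] ρ
up-punchInℤ-neg i [] = refl
up-punchInℤ-neg i (y ∷ ys) = cong₂ _∧_ (neg-<ᵇ-punchInℤ i y) (proj₂ (up-down-punchInℤ i y ys))

bit : Bool → ℕ
bit b = if b then 1 else 0

length-filter-cons : ∀ (p : ℤ → Bool) x xs → length (filterᵇ p (x ∷ xs)) ≡ bit (p x) ℕ.+ length (filterᵇ p xs)
length-filter-cons p x xs with p x
... | true = refl
... | false = refl

length-filter-map : ∀ (p q : ℤ → Bool) (f : ℤ → ℤ) xs → (∀ x → p (f x) ≡ q x) →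
  length (filterᵇ p (map f xs)) ≡ length (filterᵇ q xs)
length-filter-map p q f [] e = refl
length-filter-map p q f (x ∷ xs) e
  rewrite length-filter-cons p (f x) (map f xs) | length-filter-cons q x xs | e x | length-filter-map p q f xs e = refl

countAbs< : ℕ → List ℤ → ℕ
countAbs< m ρ = length (filterᵇ (λ z → does (∣ z ∣ ℕ.<? m)) ρ)

-- Exactly j letters of absolute value ≤ j, for each j ≤ n: all that sums over 𝔅ₙ need to know of their terms.
Standard : ℕ → List ℤ → Set
Standard n ρ = ∀ j → j ≤ n → countAbs< (suc j) ρ ≡ j

countAbs<-punchInℤ-below : ∀ i j → j ≤ i → ∀ ρ → countAbs< (suc j) (map (punchInℤ i) ρ) ≡ countAbs< (suc j) ρ
countAbs<-punchInℤ-below i j j≤i ρ = length-filter-map _ _ (punchInℤ i) ρ λ z →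
  trans (cong (λ m → does (m ℕ.<? suc j)) (∣punchInℤ∣ i z))
        (does-⇔ (_ ℕ.<? suc j) (∣ z ∣ ℕ.<? suc j) (punchIn-<-below ∣ z ∣ (s≤s j≤i)) (<-punchIn-below ∣ z ∣ (s≤s j≤i)))

countAbs<-punchInℤ-above : ∀ i j → i ≤ j → ∀ ρ → countAbs< (suc (suc j)) (map (punchInℤ i) ρ) ≡ countAbs< (suc j) ρ
countAbs<-punchInℤ-above i j i≤j ρ = length-filter-map _ _ (punchInℤ i) ρ λ z →
  trans (cong (λ m → does (m ℕ.<? suc (suc j))) (∣punchInℤ∣ i z))
        (does-⇔ (_ ℕ.<? suc (suc j)) (∣ z ∣ ℕ.<? suc j) (punchIn-<-above ∣ z ∣ (s≤s i≤j)) (<-punchIn-above ∣ z ∣ (s≤s i≤j)))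

Standard-◁ : ∀ m i → i ≤ m → (a : ℤ) → ∣ a ∣ ≡ suc i → ∀ ρ → Standard m ρ → Standard (suc m) (a ∷ map (punchInℤ i) ρ)
Standard-◁ m i i≤m a ∣a∣ ρ std j j≤1+m rewrite length-filter-cons (λ z → does (∣ z ∣ ℕ.<? suc j)) a (map (punchInℤ i) ρ) | ∣a∣
  with ℕP.<-cmp i j
... | tri< i<j _ _ with j | i<j | j≤1+m
...   | suc j′ | s≤s i≤j′ | s≤s j′≤m
  rewrite dec-true (suc i ℕ.<? suc (suc j′)) (s≤s (s≤s i≤j′)) | countAbs<-punchInℤ-above i j′ i≤j′ ρ = cong suc (std j′ j′≤m)
Standard-◁ m i i≤m a ∣a∣ ρ std j j≤1+m | tri≈ _ refl _
  rewrite dec-false (suc i ℕ.<? suc i) (ℕP.<-irrefl refl) | countAbs<-punchInℤ-below i i ℕP.≤-refl ρ = std i i≤m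
Standard-◁ m i i≤m a ∣a∣ ρ std j j≤1+m | tri> _ _ j<i
  rewrite dec-false (suc i ℕ.<? suc j) (λ h → ℕP.<-asym j<i (ℕP.≤-pred h)) | countAbs<-punchInℤ-below i j (ℕP.<⇒≤ j<i) ρ
  = std j (ℕP.≤-trans (ℕP.<⇒≤ j<i) i≤m)

sumB-cong-Standard : ∀ n {F G : List ℤ → ℤ} → (∀ ρ → Standard n ρ → F ρ ≡ G ρ) → sumB n F ≡ sumB n G
sumB-cong-Standard zero {F} {G} h = cong (_+ 0ℤ) (h [] λ { zero z≤n → refl })
sumB-cong-Standard (suc n) {F} {G} h = begin
  sumB (suc n) F
    ≡⟨ sumB-suc n F ⟩
  sumList (entries (suc n)) (λ a → sumB n (λ ρ → F (a ◁ ρ)))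
    ≡⟨ sumList-entries-cong (suc n) {F = λ a → sumB n (λ ρ → F (a ◁ ρ))} {G = λ a → sumB n (λ ρ → G (a ◁ ρ))}
         (λ k k< → sumB-cong-Standard n (λ ρ std → h _ (Standard-◁ n k (ℕP.≤-pred k<) (+ suc k) refl ρ std)))
         (λ k k< → sumB-cong-Standard n (λ ρ std → h _ (Standard-◁ n k (ℕP.≤-pred k<) -[1+ k ] refl ρ std))) ⟩
  sumList (entries (suc n)) (λ a → sumB n (λ ρ → G (a ◁ ρ)))
    ≡⟨ sym (sumB-suc n G) ⟩
  sumB (suc n) G ∎
  where open ≡-Reasoning

-1^-suc : ∀ n → -1ℤ ^ suc n ≡ - (-1ℤ ^ n)
-1^-suc n = ℤP.-1*i≡-i (-1ℤ ^ n)

-1^-2+ : ∀ n → -1ℤ ^ suc (suc n) ≡ -1ℤ ^ n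
-1^-2+ n = trans (-1^-suc (suc n)) (trans (cong -_ (-1^-suc n)) (ℤP.neg-involutive _))

neg-map-punchInℤ : ∀ i ρ → neg (map (punchInℤ i) ρ) ≡ neg ρ
neg-map-punchInℤ i ρ = length-filter-map _ _ (punchInℤ i) ρ (punchInℤ-<ᵇ-0 i)

invB-map-punchInℤ : ∀ i ρ → invB (map (punchInℤ i) ρ) ≡ invB ρ
invB-map-punchInℤ i [] = refl
invB-map-punchInℤ i (x ∷ xs) = cong₂ ℕ._+_ (cong₂ ℕ._+_ (cong₂ ℕ._+_
   (length-filter-map _ _ (punchInℤ i) xs (λ y → punchInℤ-<ᵇ i y x))
   (length-filter-map _ _ (punchInℤ i) xs (λ y → trans (cong (punchInℤ i y <ℤ_) (neg-punchInℤ i x)) (punchInℤ-<ᵇ i y (- x)))))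
   (cong bit (punchInℤ-<ᵇ-0 i x)))
   (invB-map-punchInℤ i xs)

-- A letter z with -i ≤ z ≤ i lies below +(i+1) only; one with z < -i lies below both +(i+1) and -(i+1).
parity-below-±1+i : ∀ i z → -1ℤ ^ (bit (z <ℤ + suc i) ℕ.+ bit (z <ℤ - (+ i))) ≡ -1ℤ ^ bit (does (∣ z ∣ ℕ.<? suc i))
parity-below-±1+i zero (+ zero) = refl
parity-below-±1+i (suc i) (+ zero) = refl
parity-below-±1+i zero (+ suc k) rewrite pos≮ᵇpos {suc k} {0} (λ ()) = cong (-1ℤ ^_) (ℕP.+-identityʳ (bit (does (suc k ℕ.<? 1))))
parity-below-±1+i (suc i) (+ suc k) rewrite pos≮ᵇneg (suc k) i = cong (-1ℤ ^_) (ℕP.+-identityʳ (bit (does (suc k ℕ.<? suc (suc i)))))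
parity-below-±1+i zero -[1+ k ] rewrite neg<ᵇpos k 1 | neg<ᵇpos k 0 | dec-false (suc k ℕ.<? 1) (λ { (s≤s ()) }) = refl
parity-below-±1+i (suc i) -[1+ k ] rewrite neg<ᵇpos k (suc (suc i)) with ℕP.<-cmp k i
... | tri< k<i _ _ rewrite neg≮ᵇneg {k} {i} (ℕP.<⇒≯ k<i) | dec-true (suc k ℕ.<? suc (suc i)) (s≤s (ℕP.<⇒≤ (s≤s k<i))) = refl
... | tri≈ _ refl _ rewrite neg≮ᵇneg {k} {k} (ℕP.<-irrefl refl) | dec-true (suc k ℕ.<? suc (suc k)) ℕP.≤-refl = refl
... | tri> _ _ i<k rewrite neg<ᵇneg i<k | dec-false (suc k ℕ.<? suc (suc i)) (λ h → ℕP.<⇒≱ i<k (ℕP.≤-pred (ℕP.≤-pred h))) = refl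

parity-below-punchInℤ : ∀ i ρ →
  -1ℤ ^ (length (filterᵇ (_<ℤ + suc i) (map (punchInℤ i) ρ)) ℕ.+ length (filterᵇ (_<ℤ -[1+ i ]) (map (punchInℤ i) ρ)))
  ≡ -1ℤ ^ countAbs< (suc i) ρ
parity-below-punchInℤ i [] = refl
parity-below-punchInℤ i (z ∷ ρ) = begin
  -1ℤ ^ (length (filterᵇ (_<ℤ + suc i) (z′ ∷ map (punchInℤ i) ρ)) ℕ.+ length (filterᵇ (_<ℤ -[1+ i ]) (z′ ∷ map (punchInℤ i) ρ)))
    ≡⟨ cong₂ (λ a b → -1ℤ ^ (a ℕ.+ b)) (length-filter-cons (_<ℤ + suc i) z′ _) (length-filter-cons (_<ℤ -[1+ i ]) z′ _) ⟩
  -1ℤ ^ ((bit (z′ <ℤ + suc i) ℕ.+ L+) ℕ.+ (bit (z′ <ℤ -[1+ i ]) ℕ.+ L-))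
    ≡⟨ cong (-1ℤ ^_) (ℕ+-interchange (bit (z′ <ℤ + suc i)) L+ (bit (z′ <ℤ -[1+ i ])) L-) ⟩
  -1ℤ ^ ((bit (z′ <ℤ + suc i) ℕ.+ bit (z′ <ℤ -[1+ i ])) ℕ.+ (L+ ℕ.+ L-))
    ≡⟨ ℤP.^-distribˡ-+-* -1ℤ (bit (z′ <ℤ + suc i) ℕ.+ bit (z′ <ℤ -[1+ i ])) (L+ ℕ.+ L-) ⟩
  -1ℤ ^ (bit (z′ <ℤ + suc i) ℕ.+ bit (z′ <ℤ -[1+ i ])) * -1ℤ ^ (L+ ℕ.+ L-)
    ≡⟨ cong₂ _*_ head (parity-below-punchInℤ i ρ) ⟩
  -1ℤ ^ bit (does (∣ z ∣ ℕ.<? suc i)) * -1ℤ ^ countAbs< (suc i) ρ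
    ≡⟨ sym (ℤP.^-distribˡ-+-* -1ℤ (bit (does (∣ z ∣ ℕ.<? suc i))) (countAbs< (suc i) ρ)) ⟩
  -1ℤ ^ (bit (does (∣ z ∣ ℕ.<? suc i)) ℕ.+ countAbs< (suc i) ρ)
    ≡⟨ cong (-1ℤ ^_) (sym (length-filter-cons (λ z → does (∣ z ∣ ℕ.<? suc i)) z ρ)) ⟩
  -1ℤ ^ countAbs< (suc i) (z ∷ ρ) ∎
  where
  open ≡-Reasoning
  z′ = punchInℤ i z
  L+ = length (filterᵇ (_<ℤ + suc i) (map (punchInℤ i) ρ))
  L- = length (filterᵇ (_<ℤ -[1+ i ]) (map (punchInℤ i) ρ))
  head : -1ℤ ^ (bit (z′ <ℤ + suc i) ℕ.+ bit (z′ <ℤ -[1+ i ])) ≡ -1ℤ ^ bit (does (∣ z ∣ ℕ.<? suc i))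
  head rewrite punchInℤ-<ᵇ-pos i z | punchInℤ-<ᵇ-neg i z = parity-below-±1+i i z

negSign invSign : List ℤ → ℤ
negSign π = -1ℤ ^ neg π
invSign π = -1ℤ ^ invB π

negSignLetter invSignLetter : ℤ → ℤ
negSignLetter (+ n) = 1ℤ
negSignLetter -[1+ n ] = -1ℤ
invSignLetter (+ n) = -1ℤ ^ (n ∸ 1)
invSignLetter -[1+ n ] = - (-1ℤ ^ n)

Multiplicative : (List ℤ → ℤ) → (ℤ → ℤ) → Set
Multiplicative W φ = ∀ n i → i ≤ n → ∀ ρ → Standard n ρ →
  (W (+ suc i ◁ ρ) ≡ φ (+ suc i) * W ρ) × (W (-[1+ i ] ◁ ρ) ≡ φ -[1+ i ] * W ρ)

negSign-multiplicative : Multiplicative negSign negSignLetter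
negSign-multiplicative n i _ ρ _ rewrite neg-map-punchInℤ i ρ = sym (ℤP.*-identityˡ _) , refl

invSign-multiplicative : Multiplicative invSign invSignLetter
invSign-multiplicative n i i≤n ρ std = pos , negative
  where
  xs = map (punchInℤ i) ρ
  below+ = length (filterᵇ (_<ℤ + suc i) xs)
  below- = length (filterᵇ (_<ℤ -[1+ i ]) xs)
  parity : -1ℤ ^ (below+ ℕ.+ below-) ≡ -1ℤ ^ i
  parity = trans (parity-below-punchInℤ i ρ) (cong (-1ℤ ^_) (std i i≤n))
  pos : invSign (+ suc i ◁ ρ) ≡ -1ℤ ^ i * invSign ρ
  pos = begin
    -1ℤ ^ ((below+ ℕ.+ below- ℕ.+ 0) ℕ.+ invB xs)
      ≡⟨ ℤP.^-distribˡ-+-* -1ℤ (below+ ℕ.+ below- ℕ.+ 0) (invB xs) ⟩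
    -1ℤ ^ (below+ ℕ.+ below- ℕ.+ 0) * -1ℤ ^ invB xs
      ≡⟨ cong₂ (λ e f → -1ℤ ^ e * -1ℤ ^ f) (ℕP.+-identityʳ (below+ ℕ.+ below-)) (invB-map-punchInℤ i ρ) ⟩
    -1ℤ ^ (below+ ℕ.+ below-) * invSign ρ
      ≡⟨ cong (_* invSign ρ) parity ⟩
    -1ℤ ^ i * invSign ρ ∎
    where open ≡-Reasoning
  negative : invSign (-[1+ i ] ◁ ρ) ≡ - (-1ℤ ^ i) * invSign ρ
  negative = begin
    -1ℤ ^ ((below- ℕ.+ below+ ℕ.+ 1) ℕ.+ invB xs)
      ≡⟨ ℤP.^-distribˡ-+-* -1ℤ (below- ℕ.+ below+ ℕ.+ 1) (invB xs) ⟩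
    -1ℤ ^ (below- ℕ.+ below+ ℕ.+ 1) * -1ℤ ^ invB xs
      ≡⟨ cong₂ (λ e f → -1ℤ ^ e * -1ℤ ^ f) (trans (ℕP.+-comm (below- ℕ.+ below+) 1) (cong suc (ℕP.+-comm below- below+)))
                                         (invB-map-punchInℤ i ρ) ⟩
    -1ℤ ^ suc (below+ ℕ.+ below-) * invSign ρ
      ≡⟨ cong (_* invSign ρ) (trans (-1^-suc (below+ ℕ.+ below-)) (cong -_ parity)) ⟩
    - (-1ℤ ^ i) * invSign ρ ∎
    where open ≡-Reasoning

upCount downCount : (List ℤ → ℤ) → ℕ → ℤ → ℤ
upCount W n t = sumB n (λ π → 𝟙 (up t π) * W π)
downCount W n t = sumB n (λ π → 𝟙 (down t π) * W π)

-- After the first letter a, the comparisons with a of the relabelled rest are comparisons with these.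
descentBound ascentBound : ℤ → ℤ
descentBound (+ n) = + n
descentBound -[1+ i ] = - (+ i)
ascentBound (+ zero) = + zero
ascentBound (+ suc i) = + i
ascentBound -[1+ i ] = -[1+ i ]

𝟙-∧ : ∀ b c → 𝟙 (b ∧ c) ≡ 𝟙 b * 𝟙 c
𝟙-∧ true c = sym (ℤP.*-identityˡ (𝟙 c))
𝟙-∧ false c = refl

sumB-factor : ∀ n b c (p q : List ℤ → Bool) (V W : List ℤ → ℤ) →
  (∀ ρ → p ρ ≡ q ρ) → (∀ ρ → Standard n ρ → V ρ ≡ c * W ρ) →
  sumB n (λ ρ → 𝟙 (b ∧ p ρ) * V ρ) ≡ (𝟙 b * c) * sumB n (λ ρ → 𝟙 (q ρ) * W ρ)
sumB-factor n b c p q V W p≡q V≡cW = trans (sumB-cong-Standard n pointwise) (sumList-* (B n) (𝟙 b * c) _)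
  where
  rearrange : ∀ (x y c w : ℤ) → (x * y) * (c * w) ≡ (x * c) * (y * w)
  rearrange = solve-∀
  pointwise : ∀ ρ → Standard n ρ → 𝟙 (b ∧ p ρ) * V ρ ≡ (𝟙 b * c) * (𝟙 (q ρ) * W ρ)
  pointwise ρ std = trans (cong₂ _*_ (trans (𝟙-∧ b (p ρ)) (cong (λ x → 𝟙 b * 𝟙 x) (p≡q ρ))) (V≡cW ρ std))
                          (rearrange (𝟙 b) (𝟙 (q ρ)) c (W ρ))

module _ (W : List ℤ → ℤ) (φ : ℤ → ℤ) (mult : Multiplicative W φ) where

  upCount-suc : ∀ n t → upCount W (suc n) t ≡ sumList (entries (suc n)) (λ a → (𝟙 (t <ℤ a) * φ a) * downCount W n (descentBound a))
  upCount-suc n t = trans (sumB-suc n _) (sumList-entries-cong (suc n)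
    {F = λ a → sumB n (λ ρ → 𝟙 (up t (a ◁ ρ)) * W (a ◁ ρ))}
    {G = λ a → (𝟙 (t <ℤ a) * φ a) * downCount W n (descentBound a)}
    (λ k k< → sumB-factor n (t <ℤ + suc k) (φ (+ suc k)) _ _ _ W (down-punchInℤ-pos k) (λ ρ std → proj₁ (mult n k (ℕP.≤-pred k<) ρ std)))
    (λ k k< → sumB-factor n (t <ℤ -[1+ k ]) (φ -[1+ k ]) _ _ _ W (down-punchInℤ-neg k) (λ ρ std → proj₂ (mult n k (ℕP.≤-pred k<) ρ std))))

  downCount-suc : ∀ n t → downCount W (suc n) t ≡ sumList (entries (suc n)) (λ a → (𝟙 (a <ℤ t) * φ a) * upCount W n (ascentBound a))
  downCount-suc n t = trans (sumB-suc n _) (sumList-entries-cong (suc n)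
    {F = λ a → sumB n (λ ρ → 𝟙 (down t (a ◁ ρ)) * W (a ◁ ρ))}
    {G = λ a → (𝟙 (a <ℤ t) * φ a) * upCount W n (ascentBound a)}
    (λ k k< → sumB-factor n (+ suc k <ℤ t) (φ (+ suc k)) _ _ _ W (up-punchInℤ-pos k) (λ ρ std → proj₁ (mult n k (ℕP.≤-pred k<) ρ std)))
    (λ k k< → sumB-factor n (-[1+ k ] <ℤ t) (φ -[1+ k ]) _ _ _ W (up-punchInℤ-neg k) (λ ρ std → proj₂ (mult n k (ℕP.≤-pred k<) ρ std))))

-- dcos n, dsin n, dcos+sin n, dcos-sin n are the n-th derivatives at 0 of cos, sin, cos + sin, cos - sin.
mutual
  dcos dsin : ℕ → ℤ
  dcos zero = 1ℤ
  dcos (suc i) = - dsin i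
  dsin zero = 0ℤ
  dsin (suc i) = dcos i

mutual
  dcos+sin dcos-sin : ℕ → ℤ
  dcos+sin zero = 1ℤ
  dcos+sin (suc i) = dcos-sin i
  dcos-sin zero = 1ℤ
  dcos-sin (suc i) = - dcos+sin i

record SignedCounts (W : List ℤ → ℤ) (n : ℕ) : Set where
  field
    down-+1 : downCount W n (+ 1) ≡ dcos-sin n
    down-0 : downCount W n (+ 0) ≡ dcos-sin n
    down-pos : ∀ k → k < n → downCount W n (+ suc (suc k)) ≡ 0ℤ
    down-neg : ∀ k → k < n → downCount W n -[1+ k ] ≡ 0ℤ
    up-0 : upCount W n (+ 0) ≡ dcos+sin n
    up--1 : upCount W n -1ℤ ≡ dcos+sin n
    up-pos : ∀ k → k < n → upCount W n (+ suc k) ≡ 0ℤ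
    up-neg : ∀ k → k < n → upCount W n -[1+ suc k ] ≡ 0ℤ

module SignedCountsOf (W : List ℤ → ℤ) (φ : ℤ → ℤ) (mult : Multiplicative W φ)
                      (φ-+1 : φ (+ 1) ≡ 1ℤ) (φ--1 : φ -1ℤ ≡ -1ℤ) (W-[] : W [] ≡ 1ℤ) where

  private
    *-vanish : ∀ x {y} → y ≡ 0ℤ → x * y ≡ 0ℤ
    *-vanish x refl = ℤP.*-zeroʳ x

    combine : ∀ (a b e : ℤ) → (a * 1ℤ) * e + (b * -1ℤ) * e ≡ e * (a - b)
    combine = solve-∀

  upCount-suc-closed : ∀ n → SignedCounts W n → ∀ t → upCount W (suc n) t ≡ dcos-sin n * (𝟙 (t <ℤ + 1) - 𝟙 (t <ℤ -1ℤ))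
  upCount-suc-closed n S t = begin
    upCount W (suc n) t
      ≡⟨ upCount-suc W φ mult n t ⟩
    sumList (entries (suc n)) (λ a → (𝟙 (t <ℤ a) * φ a) * downCount W n (descentBound a))
      ≡⟨ sumList-entries-±1 n (λ a → (𝟙 (t <ℤ a) * φ a) * downCount W n (descentBound a))
           (λ k k< → *-vanish (𝟙 (t <ℤ + suc (suc k)) * φ (+ suc (suc k))) (down-pos k k<))
           (λ k k< → *-vanish (𝟙 (t <ℤ -[1+ suc k ]) * φ -[1+ suc k ]) (down-neg k k<)) ⟩
    (𝟙 (t <ℤ + 1) * φ (+ 1)) * downCount W n (+ 1) + (𝟙 (t <ℤ -1ℤ) * φ -1ℤ) * downCount W n (+ 0)
      ≡⟨ cong₂ (λ x y → (𝟙 (t <ℤ + 1) * x) * downCount W n (+ 1) + (𝟙 (t <ℤ -1ℤ) * y) * downCount W n (+ 0)) φ-+1 φ--1 ⟩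
    (𝟙 (t <ℤ + 1) * 1ℤ) * downCount W n (+ 1) + (𝟙 (t <ℤ -1ℤ) * -1ℤ) * downCount W n (+ 0)
      ≡⟨ cong₂ (λ x y → (𝟙 (t <ℤ + 1) * 1ℤ) * x + (𝟙 (t <ℤ -1ℤ) * -1ℤ) * y) down-+1 down-0 ⟩
    (𝟙 (t <ℤ + 1) * 1ℤ) * dcos-sin n + (𝟙 (t <ℤ -1ℤ) * -1ℤ) * dcos-sin n
      ≡⟨ combine (𝟙 (t <ℤ + 1)) (𝟙 (t <ℤ -1ℤ)) (dcos-sin n) ⟩
    dcos-sin n * (𝟙 (t <ℤ + 1) - 𝟙 (t <ℤ -1ℤ)) ∎
    where
    open ≡-Reasoning
    open SignedCounts S

  downCount-suc-closed : ∀ n → SignedCounts W n → ∀ t → downCount W (suc n) t ≡ dcos+sin n * (𝟙 (+ 1 <ℤ t) - 𝟙 (-1ℤ <ℤ t))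
  downCount-suc-closed n S t = begin
    downCount W (suc n) t
      ≡⟨ downCount-suc W φ mult n t ⟩
    sumList (entries (suc n)) (λ a → (𝟙 (a <ℤ t) * φ a) * upCount W n (ascentBound a))
      ≡⟨ sumList-entries-±1 n (λ a → (𝟙 (a <ℤ t) * φ a) * upCount W n (ascentBound a))
           (λ k k< → *-vanish (𝟙 (+ suc (suc k) <ℤ t) * φ (+ suc (suc k))) (up-pos k k<))
           (λ k k< → *-vanish (𝟙 (-[1+ suc k ] <ℤ t) * φ -[1+ suc k ]) (up-neg k k<)) ⟩
    (𝟙 (+ 1 <ℤ t) * φ (+ 1)) * upCount W n (+ 0) + (𝟙 (-1ℤ <ℤ t) * φ -1ℤ) * upCount W n -1ℤ
      ≡⟨ cong₂ (λ x y → (𝟙 (+ 1 <ℤ t) * x) * upCount W n (+ 0) + (𝟙 (-1ℤ <ℤ t) * y) * upCount W n -1ℤ) φ-+1 φ--1 ⟩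
    (𝟙 (+ 1 <ℤ t) * 1ℤ) * upCount W n (+ 0) + (𝟙 (-1ℤ <ℤ t) * -1ℤ) * upCount W n -1ℤ
      ≡⟨ cong₂ (λ x y → (𝟙 (+ 1 <ℤ t) * 1ℤ) * x + (𝟙 (-1ℤ <ℤ t) * -1ℤ) * y) up-0 up--1 ⟩
    (𝟙 (+ 1 <ℤ t) * 1ℤ) * dcos+sin n + (𝟙 (-1ℤ <ℤ t) * -1ℤ) * dcos+sin n
      ≡⟨ combine (𝟙 (+ 1 <ℤ t)) (𝟙 (-1ℤ <ℤ t)) (dcos+sin n) ⟩
    dcos+sin n * (𝟙 (+ 1 <ℤ t) - 𝟙 (-1ℤ <ℤ t)) ∎
    where
    open ≡-Reasoning
    open SignedCounts S

  signedCounts : ∀ n → SignedCounts W n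
  signedCounts zero = record
    { down-+1 = empty ; down-0 = empty ; down-pos = λ _ () ; down-neg = λ _ ()
    ; up-0 = empty ; up--1 = empty ; up-pos = λ _ () ; up-neg = λ _ () }
    where
    empty : 1ℤ * W [] + 0ℤ ≡ 1ℤ
    empty rewrite W-[] = refl
  signedCounts (suc n) = record
    { down-+1 = trans (downCount-suc-closed n S (+ 1)) (negate (dcos+sin n))
    ; down-0 = trans (downCount-suc-closed n S (+ 0)) (negate (dcos+sin n))
    ; down-pos = λ k _ → trans (downCount-suc-closed n S (+ suc (suc k))) (ℤP.*-zeroʳ (dcos+sin n))
    ; down-neg = λ k _ → trans (downCount-suc-closed n S -[1+ k ]) (ℤP.*-zeroʳ (dcos+sin n))
    ; up-0 = trans (upCount-suc-closed n S (+ 0)) (ℤP.*-identityʳ (dcos-sin n))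
    ; up--1 = trans (upCount-suc-closed n S -1ℤ) (ℤP.*-identityʳ (dcos-sin n))
    ; up-pos = λ k _ → trans (upCount-suc-closed n S (+ suc k)) (ℤP.*-zeroʳ (dcos-sin n))
    ; up-neg = λ k _ → trans (upCount-suc-closed n S -[1+ suc k ]) (ℤP.*-zeroʳ (dcos-sin n))
    }
    where
    S = signedCounts n
    negate : ∀ (x : ℤ) → x * (0ℤ - 1ℤ) ≡ - x
    negate = solve-∀

  signedSnakes : ∀ n → upCount W n (+ 0) ≡ dcos+sin n
  signedSnakes n = SignedCounts.up-0 (signedCounts n)

-- Entringer and Springer numbers of type B

entringerUp entringerDown : ℕ → ℤ → ℤ
entringerUp = upCount (λ _ → 1ℤ)
entringerDown = downCount (λ _ → 1ℤ)

-- The number of snakes of type B of size n ≥ 1 (and 1 for n = 0).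
springer : ℕ → ℤ
springer n = entringerUp n (+ 0)

neg-<ᵇ-swap : ∀ x t → (- x <ℤ t) ≡ (- t <ℤ x)
neg-<ᵇ-swap x t = does-⇔ (- x ℤ.<? t) (- t ℤ.<? x)
  (λ h → subst (- t ℤ.<_) (ℤP.neg-involutive x) (ℤP.neg-mono-< h))
  (λ h → subst (- x ℤ.<_) (ℤP.neg-involutive t) (ℤP.neg-mono-< h))

<ᵇ-neg-swap : ∀ x t → (t <ℤ - x) ≡ (x <ℤ - t)
<ᵇ-neg-swap x t = does-⇔ (t ℤ.<? - x) (x ℤ.<? - t)
  (λ h → subst (ℤ._< - t) (ℤP.neg-involutive x) (ℤP.neg-mono-< h))
  (λ h → subst (ℤ._< - x) (ℤP.neg-involutive t) (ℤP.neg-mono-< h))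

down-up-neg : ∀ t xs → (down t (map -_ xs) ≡ up (- t) xs) × (up t (map -_ xs) ≡ down (- t) xs)
down-up-neg t [] = refl , refl
down-up-neg t (x ∷ xs) =
  cong₂ _∧_ (neg-<ᵇ-swap x t) (trans (proj₂ (down-up-neg (- x) xs)) (cong (λ z → down z xs) (ℤP.neg-involutive x))) ,
  cong₂ _∧_ (<ᵇ-neg-swap x t) (trans (proj₁ (down-up-neg (- x) xs)) (cong (λ z → up z xs) (ℤP.neg-involutive x)))

entringerDown≡entringerUp-neg : ∀ n t → entringerDown n t ≡ entringerUp n (- t)
entringerDown≡entringerUp-neg n t =
  trans (sumB-neg n _) (sumB-cong n (λ π → cong (λ b → 𝟙 b * 1ℤ) (proj₁ (down-up-neg t π))))

entringerUpPos entringerUpNeg : ℕ → ℤ → ℤ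
entringerUpPos n t = sumBelow (suc n) (λ k → 𝟙 (t <ℤ + suc k) * entringerDown n (+ suc k))
entringerUpNeg n t = sumBelow (suc n) (λ k → 𝟙 (t <ℤ -[1+ k ]) * entringerDown n (- (+ k)))

entringerUp-suc : ∀ n t → entringerUp (suc n) t ≡ entringerUpPos n t + entringerUpNeg n t
entringerUp-suc n t = trans (upCount-suc (λ _ → 1ℤ) (λ _ → 1ℤ) (λ _ _ _ _ _ → refl , refl) n t)
  (trans (sumList-entries (suc n) (λ a → (𝟙 (t <ℤ a) * 1ℤ) * entringerDown n (descentBound a))) (cong₂ _+_
     (sumBelow-cong (suc n) (λ k _ → cong (_* entringerDown n (+ suc k)) (ℤP.*-identityʳ (𝟙 (t <ℤ + suc k)))))
     (sumBelow-cong (suc n) (λ k _ → cong (_* entringerDown n (- (+ k))) (ℤP.*-identityʳ (𝟙 (t <ℤ -[1+ k ])))))))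

𝟙-true : ∀ {b} → b ≡ true → 𝟙 b ≡ 1ℤ
𝟙-true refl = refl

𝟙-false : ∀ {b} → b ≡ false → 𝟙 b ≡ 0ℤ
𝟙-false refl = refl

sumBelow-threshold-pos : ∀ N s → s < N → (f : ℕ → ℤ) →
  sumBelow N (λ k → 𝟙 (+ s <ℤ + suc k) * f k) ≡ sumBelow N (λ k → 𝟙 (+ suc s <ℤ + suc k) * f k) + f s
sumBelow-threshold-pos (suc N) s s<1+N f with ℕP.m≤n⇒m<n∨m≡n (ℕP.≤-pred s<1+N)
... | inj₁ s<N
  rewrite sumBelow-threshold-pos N s s<N f
        | 𝟙-true (pos<ᵇpos {s} {suc N} (ℕP.m<n⇒m<1+n s<N)) | 𝟙-true (pos<ᵇpos {suc s} {suc N} (s≤s s<N))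
  = shift (sumBelow N (λ k → 𝟙 (+ suc s <ℤ + suc k) * f k)) (f s) (f N)
  where
  shift : ∀ (A b c : ℤ) → (A + b) + 1ℤ * c ≡ (A + 1ℤ * c) + b
  shift = solve-∀
... | inj₂ refl
  rewrite sumBelow-zero N (λ k → 𝟙 (+ s <ℤ + suc k) * f k)
            (λ k k< → cong (_* f k) (𝟙-false (pos≮ᵇpos (λ h → ℕP.<⇒≱ k< (ℕP.≤-pred h)))))
        | sumBelow-zero N (λ k → 𝟙 (+ suc s <ℤ + suc k) * f k)
            (λ k k< → cong (_* f k) (𝟙-false (pos≮ᵇpos (λ h → ℕP.<⇒≱ k< (ℕP.<⇒≤ (ℕP.≤-pred h))))))
        | 𝟙-true (pos<ᵇpos {s} {suc s} ℕP.≤-refl) | 𝟙-false (pos≮ᵇpos {suc s} {suc s} (ℕP.<-irrefl refl))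
  = shift (f s)
  where
  shift : ∀ (b : ℤ) → 0ℤ + 1ℤ * b ≡ (0ℤ + 0ℤ * b) + b
  shift = solve-∀

sumBelow-threshold-neg : ∀ N s → s < N → (f : ℕ → ℤ) →
  sumBelow N (λ k → 𝟙 (-[1+ suc s ] <ℤ -[1+ k ]) * f k) ≡ sumBelow N (λ k → 𝟙 (-[1+ s ] <ℤ -[1+ k ]) * f k) + f s
sumBelow-threshold-neg (suc N) s s<1+N f with ℕP.m≤n⇒m<n∨m≡n (ℕP.≤-pred s<1+N)
... | inj₁ s<N
  rewrite sumBelow-threshold-neg N s s<N f
        | 𝟙-false (neg≮ᵇneg {suc s} {N} (ℕP.<⇒≱ s<N ∘ ℕP.≤-pred)) | 𝟙-false (neg≮ᵇneg {s} {N} (ℕP.<-asym s<N))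
  = shift (sumBelow N (λ k → 𝟙 (-[1+ s ] <ℤ -[1+ k ]) * f k)) (f s) (f N)
  where
  shift : ∀ (A b c : ℤ) → (A + b) + 0ℤ * c ≡ (A + 0ℤ * c) + b
  shift = solve-∀
... | inj₂ refl
  rewrite sumBelow-cong N {λ k → 𝟙 (-[1+ suc s ] <ℤ -[1+ k ]) * f k} {λ k → 𝟙 (-[1+ s ] <ℤ -[1+ k ]) * f k}
            (λ k k< → cong (_* f k) (trans (𝟙-true (neg<ᵇneg (ℕP.m<n⇒m<1+n k<))) (sym (𝟙-true (neg<ᵇneg k<)))))
        | 𝟙-true (neg<ᵇneg {suc s} {s} ℕP.≤-refl) | 𝟙-false (neg≮ᵇneg {s} {s} (ℕP.<-irrefl refl))
  = shift (sumBelow s (λ k → 𝟙 (-[1+ s ] <ℤ -[1+ k ]) * f k)) (f s)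
  where
  shift : ∀ (A b : ℤ) → A + 1ℤ * b ≡ (A + 0ℤ * b) + b
  shift = solve-∀

entringerUpNeg-pos : ∀ n s → entringerUpNeg n (+ s) ≡ 0ℤ
entringerUpNeg-pos n s = sumBelow-zero (suc n) _ (λ k _ → cong (_* entringerDown n (- (+ k))) (𝟙-false (pos≮ᵇneg s k)))

entringerUp-pos-step : ∀ n s → s < suc n → entringerUp (suc n) (+ s) ≡ entringerUp (suc n) (+ suc s) + entringerUp n -[1+ s ]
entringerUp-pos-step n s s≤n = begin
  entringerUp (suc n) (+ s)
    ≡⟨ entringerUp-suc n (+ s) ⟩
  entringerUpPos n (+ s) + entringerUpNeg n (+ s)
    ≡⟨ cong₂ _+_ (sumBelow-threshold-pos (suc n) s s≤n (λ k → entringerDown n (+ suc k))) (entringerUpNeg-pos n s) ⟩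
  (entringerUpPos n (+ suc s) + entringerDown n (+ suc s)) + 0ℤ
    ≡⟨ shift (entringerUpPos n (+ suc s)) (entringerDown n (+ suc s)) ⟩
  (entringerUpPos n (+ suc s) + 0ℤ) + entringerDown n (+ suc s)
    ≡⟨ cong₂ (λ x y → (entringerUpPos n (+ suc s) + x) + y) (sym (entringerUpNeg-pos n (suc s)))
                                                              (entringerDown≡entringerUp-neg n (+ suc s)) ⟩
  (entringerUpPos n (+ suc s) + entringerUpNeg n (+ suc s)) + entringerUp n -[1+ s ]
    ≡⟨ cong (_+ entringerUp n -[1+ s ]) (sym (entringerUp-suc n (+ suc s))) ⟩
  entringerUp (suc n) (+ suc s) + entringerUp n -[1+ s ] ∎
  where
  open ≡-Reasoning
  shift : ∀ (A b : ℤ) → (A + b) + 0ℤ ≡ (A + 0ℤ) + b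
  shift = solve-∀

entringerUp-neg-step : ∀ n s → s < suc n → entringerUp (suc n) -[1+ suc s ] ≡ entringerUp (suc n) -[1+ s ] + entringerUp n (+ s)
entringerUp-neg-step n s s≤n = begin
  entringerUp (suc n) -[1+ suc s ]
    ≡⟨ entringerUp-suc n -[1+ suc s ] ⟩
  entringerUpPos n -[1+ suc s ] + entringerUpNeg n -[1+ suc s ]
    ≡⟨ cong₂ _+_ (sumBelow-cong (suc n) (λ k _ → cong (_* entringerDown n (+ suc k))
                                           (trans (𝟙-true (neg<ᵇpos (suc s) (suc k))) (sym (𝟙-true (neg<ᵇpos s (suc k)))))))
                 (sumBelow-threshold-neg (suc n) s s≤n (λ k → entringerDown n (- (+ k)))) ⟩
  entringerUpPos n -[1+ s ] + (entringerUpNeg n -[1+ s ] + entringerDown n (- (+ s)))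
    ≡⟨ sym (ℤP.+-assoc (entringerUpPos n -[1+ s ]) (entringerUpNeg n -[1+ s ]) (entringerDown n (- (+ s)))) ⟩
  (entringerUpPos n -[1+ s ] + entringerUpNeg n -[1+ s ]) + entringerDown n (- (+ s))
    ≡⟨ cong₂ _+_ (sym (entringerUp-suc n -[1+ s ]))
                 (trans (entringerDown≡entringerUp-neg n (- (+ s))) (cong (entringerUp n) (ℤP.neg-involutive (+ s)))) ⟩
  entringerUp (suc n) -[1+ s ] + entringerUp n (+ s) ∎
  where open ≡-Reasoning

entringerUp--1 : ∀ n → entringerUp (suc n) -1ℤ ≡ springer (suc n)
entringerUp--1 n = trans (entringerUp-suc n -1ℤ) (trans (cong₂ _+_
  (sumBelow-cong (suc n) (λ k _ → cong (_* entringerDown n (+ suc k))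
                                    (trans (𝟙-true (neg<ᵇpos 0 (suc k))) (sym (𝟙-true (pos<ᵇpos {0} {suc k} (s≤s z≤n)))))))
  (sumBelow-cong (suc n) (λ k _ → cong (_* entringerDown n (- (+ k)))
                                    (trans (𝟙-false (neg≮ᵇneg {0} {k} (λ ()))) (sym (𝟙-false (pos≮ᵇneg 0 k)))))))
  (sym (entringerUp-suc n (+ 0))))

entringerUp-top : ∀ n → entringerUp (suc n) (+ suc n) ≡ 0ℤ
entringerUp-top n = trans (entringerUp-suc n (+ suc n)) (trans (cong₂ _+_
  (sumBelow-zero (suc n) (λ k → 𝟙 (+ suc n <ℤ + suc k) * entringerDown n (+ suc k))
                 (λ k k< → cong (_* entringerDown n (+ suc k)) (𝟙-false (pos≮ᵇpos (λ h → ℕP.<⇒≱ h k<)))))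
  (entringerUpNeg-pos n (suc n)))
  (ℤP.+-identityʳ 0ℤ))

binomialSum : ℕ → (ℕ → ℤ) → ℤ
binomialSum s f = sumBelow (suc s) (λ i → + (s C i) * f i)

binomialSum-cong : ∀ s {f g : ℕ → ℤ} → (∀ i → f i ≡ g i) → binomialSum s f ≡ binomialSum s g
binomialSum-cong s e = sumBelow-cong (suc s) (λ i _ → cong (+ (s C i) *_) (e i))

binomialSum-neg : ∀ s (f : ℕ → ℤ) → binomialSum s (λ i → - f i) ≡ - binomialSum s f
binomialSum-neg s f =
  trans (sumBelow-cong (suc s) (λ i _ → sym (ℤP.neg-distribʳ-* (+ (s C i)) (f i)))) (sumBelow-neg (suc s) _)

binomialSum-suc : ∀ s (f : ℕ → ℤ) → binomialSum (suc s) f ≡ binomialSum s f + binomialSum s (f ∘ suc)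
binomialSum-suc s f = begin
  binomialSum (suc s) f
    ≡⟨ sumBelow-suc (suc s) _ ⟩
  1ℤ * f 0 + sumBelow (suc s) (λ i → + (suc s C suc i) * f (suc i))
    ≡⟨ cong (_+_ (1ℤ * f 0)) (trans (sumBelow-cong (suc s) (λ i _ → pascal i)) (sumBelow-+ (suc s) _ _)) ⟩
  1ℤ * f 0 + (binomialSum s (f ∘ suc) + sumBelow (suc s) (λ i → + (s C suc i) * f (suc i)))
    ≡⟨ cong (λ c → 1ℤ * f 0 + (binomialSum s (f ∘ suc) + (R + + c * f (suc s)))) (k>n⇒nCk≡0 (ℕP.n<1+n s)) ⟩
  1ℤ * f 0 + (binomialSum s (f ∘ suc) + (R + 0ℤ * f (suc s)))
    ≡⟨ regroup (f 0) (binomialSum s (f ∘ suc)) R (f (suc s)) ⟩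
  (1ℤ * f 0 + R) + binomialSum s (f ∘ suc)
    ≡⟨ cong (_+ binomialSum s (f ∘ suc)) (sym (sumBelow-suc s (λ i → + (s C i) * f i))) ⟩
  binomialSum s f + binomialSum s (f ∘ suc) ∎
  where
  open ≡-Reasoning
  R = sumBelow s (λ i → + (s C suc i) * f (suc i))
  pascal : ∀ i → + (suc s C suc i) * f (suc i) ≡ + (s C i) * f (suc i) + + (s C suc i) * f (suc i)
  pascal i = trans (cong (λ c → + c * f (suc i)) (sym (nCk+nC[k+1]≡[n+1]C[k+1] s i)))
                   (trans (cong (_* f (suc i)) (ℤP.pos-+ (s C i) (s C suc i))) (ℤP.*-distribʳ-+ (f (suc i)) (+ (s C i)) (+ (s C suc i))))
  regroup : ∀ (a b c d : ℤ) → 1ℤ * a + (b + (c + 0ℤ * d)) ≡ (1ℤ * a + c) + b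
  regroup = solve-∀

-- Seidel–Entringer–Arnold triangle of type B: each entry is a binomial transform of the Springer numbers.
entringerUp-binomial : ∀ s →
    (∀ n → s ≤ n → entringerUp n (+ s) ≡ binomialSum s (λ i → dcos-sin i * springer (n ∸ i)))
  × (∀ n → s ≤ n → entringerUp n -[1+ s ] ≡ binomialSum s (λ i → dcos+sin i * springer (n ∸ i)))
entringerUp-binomial zero = (λ n _ → unit (springer n)) , minus-one
  where
  unit : ∀ (x : ℤ) → x ≡ 0ℤ + 1ℤ * (1ℤ * x)
  unit = solve-∀
  minus-one : ∀ n → 0 ≤ n → entringerUp n -1ℤ ≡ binomialSum 0 (λ i → dcos+sin i * springer (n ∸ i))
  minus-one zero _ = refl
  minus-one (suc m) _ = trans (entringerUp--1 m) (unit (springer (suc m)))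
entringerUp-binomial (suc s) = pos , negative
  where
  IH = entringerUp-binomial s
  pos : ∀ n → suc s ≤ n → entringerUp n (+ suc s) ≡ binomialSum (suc s) (λ i → dcos-sin i * springer (n ∸ i))
  pos (suc m) (s≤s s≤m) = begin
    entringerUp (suc m) (+ suc s)
      ≡⟨ isolate (entringerUp-pos-step m s (s≤s s≤m)) ⟩
    entringerUp (suc m) (+ s) - entringerUp m -[1+ s ]
      ≡⟨ cong₂ _-_ (proj₁ IH (suc m) (ℕP.m≤n⇒m≤1+n s≤m)) (proj₂ IH m s≤m) ⟩
    binomialSum s (λ i → dcos-sin i * springer (suc m ∸ i)) - binomialSum s (λ i → dcos+sin i * springer (m ∸ i))
      ≡⟨ cong (_+_ (binomialSum s (λ i → dcos-sin i * springer (suc m ∸ i))))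
              (sym (trans (binomialSum-cong s (λ i → sym (ℤP.neg-distribˡ-* (dcos+sin i) (springer (m ∸ i)))))
                          (binomialSum-neg s _))) ⟩
    binomialSum s (λ i → dcos-sin i * springer (suc m ∸ i)) + binomialSum s (λ i → dcos-sin (suc i) * springer (suc m ∸ suc i))
      ≡⟨ sym (binomialSum-suc s _) ⟩
    binomialSum (suc s) (λ i → dcos-sin i * springer (suc m ∸ i)) ∎
    where
    open ≡-Reasoning
    +-cancelʳ : ∀ (y z : ℤ) → y ≡ (y + z) - z
    +-cancelʳ = solve-∀
    isolate : ∀ {x y z : ℤ} → x ≡ y + z → y ≡ x - z
    isolate {y = y} {z} refl = +-cancelʳ y z
  negative : ∀ n → suc s ≤ n → entringerUp n -[1+ suc s ] ≡ binomialSum (suc s) (λ i → dcos+sin i * springer (n ∸ i))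
  negative (suc m) (s≤s s≤m) = begin
    entringerUp (suc m) -[1+ suc s ]
      ≡⟨ entringerUp-neg-step m s (s≤s s≤m) ⟩
    entringerUp (suc m) -[1+ s ] + entringerUp m (+ s)
      ≡⟨ cong₂ _+_ (proj₂ IH (suc m) (ℕP.m≤n⇒m≤1+n s≤m)) (proj₁ IH m s≤m) ⟩
    binomialSum s (λ i → dcos+sin i * springer (suc m ∸ i)) + binomialSum s (λ i → dcos+sin (suc i) * springer (suc m ∸ suc i))
      ≡⟨ sym (binomialSum-suc s _) ⟩
    binomialSum (suc s) (λ i → dcos+sin i * springer (suc m ∸ i)) ∎
    where open ≡-Reasoning

springer-recurrence : ∀ m → binomialSum (suc m) (λ i → dcos-sin i * springer (suc m ∸ i)) ≡ 0ℤ
springer-recurrence m = trans (sym (proj₁ (entringerUp-binomial (suc m)) (suc m) ℕP.≤-refl)) (entringerUp-top m)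

infixl 7 _⋆_
_⋆_ : (ℕ → ℤ) → (ℕ → ℤ) → ℕ → ℤ
(f ⋆ g) n = binomialSum n (λ k → f k * g (n ∸ k))

⋆-comm : ∀ f g n → (f ⋆ g) n ≡ (g ⋆ f) n
⋆-comm f g n = trans (sumBelow-reverse (suc n) _) (sumBelow-cong (suc n) reflect)
  where
  reflect : ∀ k → k < suc n → + (n C (n ∸ k)) * (f (n ∸ k) * g (n ∸ (n ∸ k))) ≡ + (n C k) * (g k * f (n ∸ k))
  reflect k (s≤s k≤n) rewrite sym (nCk≡nC[n∸k] k≤n) | ℕP.m∸[m∸n]≡n k≤n = cong (+ (n C k) *_) (ℤP.*-comm (f (n ∸ k)) (g k))

-- Leibniz rule (f g)′ = f g′ + f′ g.
⋆-suc : ∀ f g n → (f ⋆ g) (suc n) ≡ (f ⋆ (g ∘ suc)) n + ((f ∘ suc) ⋆ g) n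
⋆-suc f g n = trans (binomialSum-suc n _) (cong (_+ ((f ∘ suc) ⋆ g) n) (sumBelow-cong (suc n) shift))
  where
  shift : ∀ k → k < suc n → + (n C k) * (f k * g (suc n ∸ k)) ≡ + (n C k) * (f k * g (suc (n ∸ k)))
  shift k (s≤s k≤n) rewrite ℕP.+-∸-assoc 1 k≤n = refl

⋆-negˡ : ∀ f g n → ((λ k → - f k) ⋆ g) n ≡ - (f ⋆ g) n
⋆-negˡ f g n = trans (binomialSum-cong n (λ k → sym (ℤP.neg-distribˡ-* (f k) (g (n ∸ k))))) (binomialSum-neg n _)

⋆-negʳ : ∀ f g n → (f ⋆ (λ k → - g k)) n ≡ - (f ⋆ g) n
⋆-negʳ f g n = trans (binomialSum-cong n (λ k → sym (ℤP.neg-distribʳ-* (f k) (g (n ∸ k))))) (binomialSum-neg n _)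

⋆-double : ∀ (f A B g : ℕ → ℤ) n → (∀ k → + 2 * f k ≡ A k + B k) → + 2 * (f ⋆ g) n ≡ (A ⋆ g) n + (B ⋆ g) n
⋆-double f A B g n split = trans (sym (sumBelow-* (suc n) (+ 2) _)) (trans (sumBelow-cong (suc n) termwise) (sumBelow-+ (suc n) _ _))
  where
  pull : ∀ (c x y : ℤ) → + 2 * (c * (x * y)) ≡ c * ((+ 2 * x) * y)
  pull = solve-∀
  distribute : ∀ (c a b y : ℤ) → c * ((a + b) * y) ≡ c * (a * y) + c * (b * y)
  distribute = solve-∀
  termwise : ∀ k → k < suc n → + 2 * (+ (n C k) * (f k * g (n ∸ k))) ≡ + (n C k) * (A k * g (n ∸ k)) + + (n C k) * (B k * g (n ∸ k))
  termwise k _ = trans (pull (+ (n C k)) (f k) (g (n ∸ k)))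
                       (trans (cong (λ z → + (n C k) * (z * g (n ∸ k))) (split k)) (distribute (+ (n C k)) (A k) (B k) (g (n ∸ k))))

δ₀ : ℕ → ℤ
δ₀ zero = 1ℤ
δ₀ (suc n) = 0ℤ

-- (cos + sin)(cos - sin) = cos 2x,  (cos ± sin)² = 1 ± sin 2x,
-- differentiated termwise by the Leibniz rule.
cos±sin-products : ∀ n →
    ((dcos+sin ⋆ dcos-sin) n ≡ (+ 2) ^ n * dcos n) × ((dcos-sin ⋆ dcos+sin) n ≡ (+ 2) ^ n * dcos n)
  × ((dcos+sin ⋆ dcos+sin) n ≡ δ₀ n + (+ 2) ^ n * dsin n) × ((dcos-sin ⋆ dcos-sin) n ≡ δ₀ n - (+ 2) ^ n * dsin n)
cos±sin-products zero = refl , refl , refl , refl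
cos±sin-products (suc n) with cos±sin-products n
... | pm , mp , pp , mm =
  trans (⋆-suc dcos+sin dcos-sin n) (trans (cong₂ _+_ (trans (⋆-negʳ dcos+sin dcos+sin n) (cong -_ pp)) mm) (r₁ (δ₀ n) ((+ 2) ^ n) (dsin n))) ,
  trans (⋆-suc dcos-sin dcos+sin n) (trans (cong₂ _+_ mm (trans (⋆-negˡ dcos+sin dcos+sin n) (cong -_ pp))) (r₂ (δ₀ n) ((+ 2) ^ n) (dsin n))) ,
  trans (⋆-suc dcos+sin dcos+sin n) (trans (cong₂ _+_ pm mp) (r₃ ((+ 2) ^ n) (dcos n))) ,
  trans (⋆-suc dcos-sin dcos-sin n)
        (trans (cong₂ _+_ (trans (⋆-negʳ dcos-sin dcos+sin n) (cong -_ mp)) (trans (⋆-negˡ dcos+sin dcos-sin n) (cong -_ pm)))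
               (r₄ ((+ 2) ^ n) (dcos n)))
  where
  r₁ : ∀ (d p s : ℤ) → - (d + p * s) + (d - p * s) ≡ (+ 2 * p) * (- s)
  r₁ = solve-∀
  r₂ : ∀ (d p s : ℤ) → (d - p * s) + - (d + p * s) ≡ (+ 2 * p) * (- s)
  r₂ = solve-∀
  r₃ : ∀ (p c : ℤ) → p * c + p * c ≡ 0ℤ + (+ 2 * p) * c
  r₃ = solve-∀
  r₄ : ∀ (p c : ℤ) → - (p * c) + - (p * c) ≡ 0ℤ - (+ 2 * p) * c
  r₄ = solve-∀

-- 2 cos² = 1 + cos 2x,  2 sin² = 1 - cos 2x,  2 cos sin = sin 2x.
cos-sin-products : ∀ n →
    (+ 2 * (dcos ⋆ dcos) n ≡ δ₀ n + (+ 2) ^ n * dcos n) × (+ 2 * (dsin ⋆ dsin) n ≡ δ₀ n - (+ 2) ^ n * dcos n)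
  × (+ 2 * (dcos ⋆ dsin) n ≡ (+ 2) ^ n * dsin n) × (+ 2 * (dsin ⋆ dcos) n ≡ (+ 2) ^ n * dsin n)
cos-sin-products zero = refl , refl , refl , refl
cos-sin-products (suc n) with cos-sin-products n
... | cc , ss , cs , sc =
  trans (cong (+ 2 *_) (trans (⋆-suc dcos dcos n) (cong₂ _+_ (⋆-negʳ dcos dsin n) (⋆-negˡ dsin dcos n))))
        (trans (r₁ ((dcos ⋆ dsin) n) ((dsin ⋆ dcos) n)) (trans (cong₂ (λ u v → - u - v) cs sc) (r₁′ ((+ 2) ^ n) (dsin n)))) ,
  trans (cong (+ 2 *_) (⋆-suc dsin dsin n))
        (trans (ℤP.*-distribˡ-+ (+ 2) ((dsin ⋆ dcos) n) ((dcos ⋆ dsin) n)) (trans (cong₂ _+_ sc cs) (r₂′ ((+ 2) ^ n) (dsin n)))) ,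
  trans (cong (+ 2 *_) (trans (⋆-suc dcos dsin n) (cong (_+_ ((dcos ⋆ dcos) n)) (⋆-negˡ dsin dsin n))))
        (trans (r₃ ((dcos ⋆ dcos) n) ((dsin ⋆ dsin) n)) (trans (cong₂ _-_ cc ss) (r₃′ (δ₀ n) ((+ 2) ^ n) (dcos n)))) ,
  trans (cong (+ 2 *_) (trans (⋆-suc dsin dcos n) (cong (_+ (dcos ⋆ dcos) n) (⋆-negʳ dsin dsin n))))
        (trans (r₄ ((dcos ⋆ dcos) n) ((dsin ⋆ dsin) n)) (trans (cong₂ _-_ cc ss) (r₃′ (δ₀ n) ((+ 2) ^ n) (dcos n))))
  where
  r₁ : ∀ (a b : ℤ) → + 2 * (- a + - b) ≡ - (+ 2 * a) - (+ 2 * b)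
  r₁ = solve-∀
  r₁′ : ∀ (p s : ℤ) → - (p * s) - (p * s) ≡ 0ℤ + (+ 2 * p) * (- s)
  r₁′ = solve-∀
  r₂′ : ∀ (p s : ℤ) → p * s + p * s ≡ 0ℤ - (+ 2 * p) * (- s)
  r₂′ = solve-∀
  r₃ : ∀ (a b : ℤ) → + 2 * (a + - b) ≡ (+ 2 * a) - (+ 2 * b)
  r₃ = solve-∀
  r₄ : ∀ (a b : ℤ) → + 2 * (- b + a) ≡ (+ 2 * a) - (+ 2 * b)
  r₄ = solve-∀
  r₃′ : ∀ (d p c : ℤ) → (d + p * c) - (d - p * c) ≡ (+ 2 * p) * c
  r₃′ = solve-∀

springer⋆dcos-sin : ∀ n → (springer ⋆ dcos-sin) n ≡ δ₀ n
springer⋆dcos-sin zero = refl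
springer⋆dcos-sin (suc m) = trans (⋆-comm springer dcos-sin (suc m)) (springer-recurrence m)

even-2+ : ∀ k → even (suc (suc k)) ≡ even k
even-2+ k = cong (_==ℕ 0) (trans (cong (ℕ._% 2) (ℕP.+-comm 2 k)) ([m+n]%n≡m%n k 2))

2*𝟙-even : ∀ k → + 2 * 𝟙 (even k) ≡ 1ℤ + 1ℤ * -1ℤ ^ k
2*𝟙-even zero = refl
2*𝟙-even (suc zero) = refl
2*𝟙-even (suc (suc k)) rewrite even-2+ k | -1^-2+ k = 2*𝟙-even k

2*𝟙-odd : ∀ k → + 2 * 𝟙 (not (even k)) ≡ 1ℤ + -1ℤ * -1ℤ ^ k
2*𝟙-odd zero = refl
2*𝟙-odd (suc zero) = refl
2*𝟙-odd (suc (suc k)) rewrite even-2+ k | -1^-2+ k = 2*𝟙-odd k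

count-sumB : ∀ (p : List ℤ → Bool) m → + count p m ≡ sumB m (λ π → if isSnake π then 𝟙 (p π) else 0ℤ)
count-sumB p m = trans (length-filter p (snakes m)) (sumList-filter isSnake (B m) (𝟙 ∘ p))

¬Standard-[] : ∀ n → ¬ Standard (suc n) []
¬Standard-[] n std with std (suc n) ℕP.≤-refl
... | ()

-- A snake is a nonempty π with up 0 π, and 𝔅ₙ has no empty word for n ≥ 1.
2*count : ∀ n (q : List ℤ → Bool) (W : List ℤ → ℤ) (c : ℤ) → (∀ π → + 2 * 𝟙 (q π) ≡ 1ℤ + c * W π) →
  upCount W (suc n) (+ 0) ≡ dcos+sin (suc n) → + 2 * + count q (suc n) ≡ springer (suc n) + c * dcos+sin (suc n)
2*count n q W c split signed = begin
  + 2 * + count q (suc n)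
    ≡⟨ cong (_*_ (+ 2)) (count-sumB q (suc n)) ⟩
  + 2 * sumB (suc n) (λ π → if isSnake π then 𝟙 (q π) else 0ℤ)
    ≡⟨ sym (sumList-* (B (suc n)) (+ 2) _) ⟩
  sumB (suc n) (λ π → + 2 * (if isSnake π then 𝟙 (q π) else 0ℤ))
    ≡⟨ sumB-cong-Standard (suc n) termwise ⟩
  sumB (suc n) (λ π → 𝟙 (up (+ 0) π) * 1ℤ + c * (𝟙 (up (+ 0) π) * W π))
    ≡⟨ sumList-+ (B (suc n)) _ _ ⟩
  springer (suc n) + sumB (suc n) (λ π → c * (𝟙 (up (+ 0) π) * W π))
    ≡⟨ cong (_+_ (springer (suc n))) (trans (sumList-* (B (suc n)) c _) (cong (_*_ c) signed)) ⟩
  springer (suc n) + c * dcos+sin (suc n) ∎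
  where
  open ≡-Reasoning
  absent : ∀ (c w : ℤ) → 0ℤ ≡ 0ℤ * 1ℤ + c * (0ℤ * w)
  absent = solve-∀
  termwise : ∀ π → Standard (suc n) π → + 2 * (if isSnake π then 𝟙 (q π) else 0ℤ) ≡ 𝟙 (up (+ 0) π) * 1ℤ + c * (𝟙 (up (+ 0) π) * W π)
  termwise [] std = ⊥-elim (¬Standard-[] n std)
  termwise (x ∷ xs) _ with isSnake (x ∷ xs)
  ... | true = trans (split (x ∷ xs)) (cong (λ w → 1ℤ + c * w) (sym (ℤP.*-identityˡ (W (x ∷ xs)))))
  ... | false = absent c (W (x ∷ xs))

module NegSigned = SignedCountsOf negSign negSignLetter negSign-multiplicative refl refl refl
module InvSigned = SignedCountsOf invSign invSignLetter invSign-multiplicative refl refl refl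

2*SD : ∀ k → + 2 * + SD k ≡ springer k + dcos+sin k
2*SD zero = refl
2*SD (suc n) = trans (2*count n inD negSign 1ℤ (2*𝟙-even ∘ neg) (NegSigned.signedSnakes (suc n)))
                     (cong (_+_ (springer (suc n))) (ℤP.*-identityˡ _))

2*SBD : ∀ k → + 2 * + SBD k ≡ springer k - dcos+sin k
2*SBD zero = refl
2*SBD (suc n) = trans (2*count n (not ∘ inD) negSign -1ℤ (2*𝟙-odd ∘ neg) (NegSigned.signedSnakes (suc n)))
                      (cong (_+_ (springer (suc n))) (ℤP.-1*i≡-i _))

2*SB+ : ∀ k → + 2 * + SB+ k ≡ springer k + dcos+sin k
2*SB+ zero = refl
2*SB+ (suc n) = trans (2*count n (even ∘ invB) invSign 1ℤ (2*𝟙-even ∘ invB) (InvSigned.signedSnakes (suc n)))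
                      (cong (_+_ (springer (suc n))) (ℤP.*-identityˡ _))

2*SB- : ∀ k → + 2 * + SB- k ≡ springer k - dcos+sin k
2*SB- zero = refl
2*SB- (suc n) = trans (2*count n (not ∘ even ∘ invB) invSign -1ℤ (2*𝟙-odd ∘ invB) (InvSigned.signedSnakes (suc n)))
                      (cong (_+_ (springer (suc n))) (ℤP.-1*i≡-i _))

⋆-dcos-sin-cos² : ∀ (a : ℕ → ℕ) → (∀ k → + 2 * + a k ≡ springer k + dcos+sin k) →
  ∀ n → ((λ k → + a k) ⋆ dcos-sin) n ≡ (dcos ⋆ dcos) n
⋆-dcos-sin-cos² a 2a≡ n = ℤP.*-cancelˡ-≡ (+ 2) _ _ (begin
  + 2 * ((λ k → + a k) ⋆ dcos-sin) n        ≡⟨ ⋆-double (λ k → + a k) springer dcos+sin dcos-sin n 2a≡ ⟩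
  (springer ⋆ dcos-sin) n + (dcos+sin ⋆ dcos-sin) n ≡⟨ cong₂ _+_ (springer⋆dcos-sin n) (proj₁ (cos±sin-products n)) ⟩
  δ₀ n + (+ 2) ^ n * dcos n                  ≡⟨ sym (proj₁ (cos-sin-products n)) ⟩
  + 2 * (dcos ⋆ dcos) n                     ∎)
  where open ≡-Reasoning

⋆-dcos-sin-sin² : ∀ (a : ℕ → ℕ) → (∀ k → + 2 * + a k ≡ springer k - dcos+sin k) →
  ∀ n → ((λ k → + a k) ⋆ dcos-sin) n ≡ (dsin ⋆ dsin) n
⋆-dcos-sin-sin² a 2a≡ n = ℤP.*-cancelˡ-≡ (+ 2) _ _ (begin
  + 2 * ((λ k → + a k) ⋆ dcos-sin) n                       ≡⟨ ⋆-double (λ k → + a k) springer (λ k → - dcos+sin k) dcos-sin n 2a≡ ⟩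
  (springer ⋆ dcos-sin) n + ((λ k → - dcos+sin k) ⋆ dcos-sin) n
    ≡⟨ cong₂ _+_ (springer⋆dcos-sin n) (trans (⋆-negˡ dcos+sin dcos-sin n) (cong -_ (proj₁ (cos±sin-products n)))) ⟩
  δ₀ n - (+ 2) ^ n * dcos n                                 ≡⟨ sym (proj₁ (proj₂ (cos-sin-products n))) ⟩
  + 2 * (dsin ⋆ dsin) n                                    ∎)
  where open ≡-Reasoning

-- z / k! as an unnormalised rational
_/!_ : ℤ → ℕ → ℚᵘ
z /! k = mkℚᵘ z (ℕ.pred (k !))

toℚᵘ-/ : ∀ z D .{{_ : ℕ.NonZero D}} → toℚᵘ (z ℚ./ D) ≃ᵘ mkℚᵘ z (ℕ.pred D)
toℚᵘ-/ z (suc D) = ℚP.toℚᵘ-fromℚᵘ (mkℚᵘ z D)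

toℚᵘ-/! : ∀ z k → toℚᵘ ((z ℚ./ k !) {{k ℕP.!≢0}}) ≃ᵘ z /! k
toℚᵘ-/! z k = toℚᵘ-/ z (k !) {{k ℕP.!≢0}}

mkℚᵘ-+ : ∀ x y d → mkℚᵘ x d ℚᵘ.+ mkℚᵘ y d ≃ᵘ mkℚᵘ (x + y) d
mkℚᵘ-+ x y d = *≡* (trans (factor x y (+ suc d)) (cong ((x + y) *_) (sym (ℤP.pos-* (suc d) (suc d)))))
  where
  factor : ∀ (x y s : ℤ) → (x * s + y * s) * s ≡ (x + y) * (s * s)
  factor = solve-∀

sumToᵘ : ℕ → (ℕ → ℚᵘ) → ℚᵘ
sumToᵘ zero f = f 0
sumToᵘ (suc n) f = sumToᵘ n f ℚᵘ.+ f (suc n)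

toℚᵘ-sumTo : ∀ n (f : ℕ → ℚ) → toℚᵘ (sumTo n f) ≃ᵘ sumToᵘ n (toℚᵘ ∘ f)
toℚᵘ-sumTo zero f = ℚᵘP.≃-refl
toℚᵘ-sumTo (suc n) f =
  ℚᵘP.≃-trans (ℚP.toℚᵘ-homo-+ (sumTo n f) (f (suc n))) (ℚᵘP.+-congˡ (toℚᵘ (f (suc n))) (toℚᵘ-sumTo n f))

sumToᵘ-cong : ∀ n {f g : ℕ → ℚᵘ} → (∀ k → k ≤ n → f k ≃ᵘ g k) → sumToᵘ n f ≃ᵘ sumToᵘ n g
sumToᵘ-cong zero h = h 0 z≤n
sumToᵘ-cong (suc n) h = ℚᵘP.+-cong (sumToᵘ-cong n (λ k k≤n → h k (ℕP.m≤n⇒m≤1+n k≤n))) (h (suc n) ℕP.≤-refl)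

sumToᵘ-mkℚᵘ : ∀ n (z : ℕ → ℤ) d → sumToᵘ n (λ k → mkℚᵘ (z k) d) ≃ᵘ mkℚᵘ (sumBelow (suc n) z) d
sumToᵘ-mkℚᵘ zero z d = ℚᵘP.≃-reflexive (cong (λ x → mkℚᵘ x d) (sym (ℤP.+-identityˡ (z 0))))
sumToᵘ-mkℚᵘ (suc n) z d =
  ℚᵘP.≃-trans (ℚᵘP.+-congˡ (mkℚᵘ (z (suc n)) d) (sumToᵘ-mkℚᵘ n z d)) (mkℚᵘ-+ (sumBelow (suc n) z) (z (suc n)) d)

/!-*-/! : ∀ n k → k ≤ n → ∀ x y → x /! k ℚᵘ.* y /! (n ∸ k) ≃ᵘ (+ (n C k) * (x * y)) /! n
/!-*-/! n k k≤n x y = *≡* (begin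
  (x * y) * + suc (ℕ.pred (n !))            ≡⟨ cong (λ m → (x * y) * + m) (!-suc-pred n) ⟩
  (x * y) * + (n !)                         ≡⟨ cong (λ m → (x * y) * + m) (sym nCk*k!*[n∸k]!≡n!) ⟩
  (x * y) * + ((n C k) ℕ.* (k ! ℕ.* (n ∸ k) !)) ≡⟨ cong ((x * y) *_) (ℤP.pos-* (n C k) (k ! ℕ.* (n ∸ k) !)) ⟩
  (x * y) * (+ (n C k) * + (k ! ℕ.* (n ∸ k) !)) ≡⟨ reassoc (x * y) (+ (n C k)) (+ (k ! ℕ.* (n ∸ k) !)) ⟩
  (+ (n C k) * (x * y)) * + (k ! ℕ.* (n ∸ k) !)
    ≡⟨ cong (λ m → (+ (n C k) * (x * y)) * + m) (sym (cong₂ ℕ._*_ (!-suc-pred k) (!-suc-pred (n ∸ k)))) ⟩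
  (+ (n C k) * (x * y)) * + (suc (ℕ.pred (k !)) ℕ.* suc (ℕ.pred ((n ∸ k) !))) ∎)
  where
  open ≡-Reasoning
  instance _ = ℕP.m*n≢0 (k !) ((n ∸ k) !) {{k ℕP.!≢0}} {{(n ∸ k) ℕP.!≢0}}
  !-suc-pred : ∀ m → suc (ℕ.pred (m !)) ≡ m !
  !-suc-pred m = ℕP.suc-pred (m !) {{m ℕP.!≢0}}
  nCk*k!*[n∸k]!≡n! : (n C k) ℕ.* (k ! ℕ.* (n ∸ k) !) ≡ n !
  nCk*k!*[n∸k]!≡n! = trans (cong (ℕ._* (k ! ℕ.* (n ∸ k) !)) (nCk≡n!/k![n-k]! k≤n)) (m/n*n≡m (k![n∸k]!∣n! k≤n))
  reassoc : ∀ (x c d : ℤ) → x * (c * d) ≡ (c * x) * d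
  reassoc = solve-∀

⊛-/! : ∀ (F G : PS) (f g : ℕ → ℤ) → (∀ k → toℚᵘ (F k) ≃ᵘ f k /! k) → (∀ k → toℚᵘ (G k) ≃ᵘ g k /! k) →
  ∀ n → toℚᵘ ((F ⊛ G) n) ≃ᵘ (f ⋆ g) n /! n
⊛-/! F G f g F≃ G≃ n =
  ℚᵘP.≃-trans (toℚᵘ-sumTo n _)
    (ℚᵘP.≃-trans (sumToᵘ-cong n termwise) (sumToᵘ-mkℚᵘ n (λ k → + (n C k) * (f k * g (n ∸ k))) (ℕ.pred (n !))))
  where
  termwise : ∀ k → k ≤ n → toℚᵘ (F k ℚ.* G (n ∸ k)) ≃ᵘ (+ (n C k) * (f k * g (n ∸ k))) /! n
  termwise k k≤n = ℚᵘP.≃-trans (ℚP.toℚᵘ-homo-* (F k) (G (n ∸ k)))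
                     (ℚᵘP.≃-trans (ℚᵘP.*-cong (F≃ k) (G≃ (n ∸ k))) (/!-*-/! n k k≤n (f k) (g (n ∸ k))))

cosPattern sinPattern : ℕ → ℤ
cosPattern 0 = 1ℤ
cosPattern 2 = -1ℤ
cosPattern _ = 0ℤ
sinPattern 1 = 1ℤ
sinPattern 3 = -1ℤ
sinPattern _ = 0ℤ

[4+k]%4≡k%4 : ∀ k → suc (suc (suc (suc k))) % 4 ≡ k % 4
[4+k]%4≡k%4 k = trans (cong (_% 4) (ℕP.+-comm 4 k)) ([m+n]%n≡m%n k 4)

dcos≡cosPattern : ∀ k → dcos k ≡ cosPattern (k % 4)
dcos≡cosPattern 0 = refl
dcos≡cosPattern 1 = refl
dcos≡cosPattern 2 = refl
dcos≡cosPattern 3 = refl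
dcos≡cosPattern (suc (suc (suc (suc k)))) =
  trans (ℤP.neg-involutive (dcos k)) (trans (dcos≡cosPattern k) (cong cosPattern (sym ([4+k]%4≡k%4 k))))

dsin≡sinPattern : ∀ k → dsin k ≡ sinPattern (k % 4)
dsin≡sinPattern 0 = refl
dsin≡sinPattern 1 = refl
dsin≡sinPattern 2 = refl
dsin≡sinPattern 3 = refl
dsin≡sinPattern (suc (suc (suc (suc k)))) =
  trans (ℤP.neg-involutive (dsin k)) (trans (dsin≡sinPattern k) (cong sinPattern (sym ([4+k]%4≡k%4 k))))

0/! : ∀ k → toℚᵘ 0ℚ ≃ᵘ 0ℤ /! k
0/! k = *≡* refl

toℚᵘ-cosPS : ∀ k → toℚᵘ (cosPS k) ≃ᵘ dcos k /! k
toℚᵘ-cosPS k with k % 4 | dcos≡cosPattern k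
... | 0 | e rewrite e = toℚᵘ-/! (+ 1) k
... | 1 | e rewrite e = 0/! k
... | 2 | e rewrite e = toℚᵘ-/! -1ℤ k
... | 3 | e rewrite e = 0/! k
... | suc (suc (suc (suc _))) | e rewrite e = 0/! k

toℚᵘ-sinPS : ∀ k → toℚᵘ (sinPS k) ≃ᵘ dsin k /! k
toℚᵘ-sinPS k with k % 4 | dsin≡sinPattern k
... | 0 | e rewrite e = 0/! k
... | 1 | e rewrite e = toℚᵘ-/! (+ 1) k
... | 2 | e rewrite e = 0/! k
... | 3 | e rewrite e = toℚᵘ-/! -1ℤ k
... | suc (suc (suc (suc _))) | e rewrite e = 0/! k

mutual
  dcos+sin≡ : ∀ i → dcos+sin i ≡ dcos i + dsin i
  dcos+sin≡ zero = refl
  dcos+sin≡ (suc i) = trans (dcos-sin≡ i) (ℤP.+-comm (dcos i) (- dsin i))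

  dcos-sin≡ : ∀ i → dcos-sin i ≡ dcos i - dsin i
  dcos-sin≡ zero = refl
  dcos-sin≡ (suc i) =
    trans (cong -_ (dcos+sin≡ i)) (trans (ℤP.neg-distrib-+ (dcos i) (dsin i)) (ℤP.+-comm (- dcos i) (- dsin i)))

toℚᵘ-cosPS⊝sinPS : ∀ k → toℚᵘ ((cosPS ⊝ sinPS) k) ≃ᵘ dcos-sin k /! k
toℚᵘ-cosPS⊝sinPS k = ℚᵘP.≃-trans (ℚP.toℚᵘ-homo-+ (cosPS k) (ℚ.- sinPS k))
  (ℚᵘP.≃-trans (ℚᵘP.+-cong (toℚᵘ-cosPS k) (ℚᵘP.≃-trans (ℚP.toℚᵘ-homo‿- (sinPS k)) (ℚᵘP.-‿cong (toℚᵘ-sinPS k))))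
  (ℚᵘP.≃-trans (mkℚᵘ-+ (dcos k) (- dsin k) (ℕ.pred (k !))) (ℚᵘP.≃-reflexive (cong (_/! k) (sym (dcos-sin≡ k))))))

egf-identity : ∀ (a : ℕ → ℕ) (g : ℕ → ℤ) (G : PS) → (∀ k → toℚᵘ (G k) ≃ᵘ g k /! k) →
  (∀ n → ((λ k → + a k) ⋆ dcos-sin) n ≡ (g ⋆ g) n) → ∀ n → (egf a ⊛ (cosPS ⊝ sinPS)) n ≡ (G ⊛ G) n
egf-identity a g G G≃ scaled n = ℚP.toℚᵘ-injective (ℚᵘP.≃-trans
  (⊛-/! (egf a) (cosPS ⊝ sinPS) (λ k → + a k) dcos-sin (λ k → toℚᵘ-/! (+ a k) k) toℚᵘ-cosPS⊝sinPS n)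
  (ℚᵘP.≃-trans (ℚᵘP.≃-reflexive (cong (_/! n) (scaled n))) (ℚᵘP.≃-sym (⊛-/! G G g g G≃ G≃ n))))

theorem65 : (∀ n → (egf SB+ ⊛ (cosPS ⊝ sinPS)) n ≡ (cosPS ⊛ cosPS) n)
    × (∀ n → (egf SB- ⊛ (cosPS ⊝ sinPS)) n ≡ (sinPS ⊛ sinPS) n)
    × (∀ n → (egf SD ⊛ (cosPS ⊝ sinPS)) n ≡ (cosPS ⊛ cosPS) n)
    × (∀ n → (egf SBD ⊛ (cosPS ⊝ sinPS)) n ≡ (sinPS ⊛ sinPS) n)
theorem65 = egf-identity SB+ dcos cosPS toℚᵘ-cosPS (⋆-dcos-sin-cos² SB+ 2*SB+)
          , egf-identity SB- dsin sinPS toℚᵘ-sinPS (⋆-dcos-sin-sin² SB- 2*SB-)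
          , egf-identity SD dcos cosPS toℚᵘ-cosPS (⋆-dcos-sin-cos² SD 2*SD)
          , egf-identity SBD dsin sinPS toℚᵘ-sinPS (⋆-dcos-sin-sin² SBD 2*SBD)
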